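{- Under the frame-wise uniform measure, almost all finite simplicial complexes have trivial automorphism group: $\lim_{N\to\infty}\mu_N(\{S\in\mathbf{K}_{SC}^N : S\text{ has trivial automorphism group}\})=1$.
   Context: Simplicial complexes are formalised as structures for the signature $\Sigma=\{S_i: i\ge1\}$, $S_i$ an $(i+1)$-ary relation symbol (so every element of the underlying set is a vertex), satisfying: General Irreflexivity ($S_n(x_0,\dots,x_n)\to x_i\ne x_j$ for distinct $i,j$), Symmetry ($S_n(x_0,\dots,x_n)\to S_n(x_{\sigma(0)},\dots,x_{\sigma(n)})$ for every permutation $\sigma$), and Subset Closure ($S_n(x_0,\dots,x_n)\to S_{n-1}(x_0,\dots,x_{n-1})$ for $n\ge2$); $S_n$ holding of the $n+1$ distinct elements means they form a face. $\mathbf{K}_{SC}$ is the class of such finite structures with underlying set a subset of $\mathbb{N}$, and $\mathbf{K}_{SC}^N$ those with underlying set $\{0,\dots,N-1\}$. For a structure $A$, the $k$-frame $A^{(k)}$ keeps relations of arity $\le k$ and empties higher ones; $A\restriction X$ is the induced substructure. For $A\in\mathbf{K}_{SC}$ with $|A|\subseteq\{0,\dots,N-1\}$ and $k\in\mathbb{N}$ let $O_N(A,k)=\{S\in\mathbf{K}^N_{SC}:(S\restriction|A|)^{(k)}=A^{(k)}\}$; $N(A,k)$ is the number of distinct $(k+1)$-frames of members $T$ of $\mathbf{K}_{SC}$ on $|A|$ with $T^{(k)}=A^{(k)}$. The frame-wise uniform measure $\mu_N$ is the probability measure on $\mathbf{K}_{SC}^N$ determined by $\mu_N(O_N(A,0))=1$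 and $\mu_N(O_N(A,k+1))=\mu_N(O_N(A,k))/N(A,k)$ (equivalently: build the complex dimension by dimension, including each candidate simplex whose proper subsets are all faces independently with probability $1/2$). -}

module Defs where

open import Data.Bool using (Bool; true; false; _∧_; _∨_; not; if_then_else_)
open import Data.Nat using (ℕ; zero; suc; _∸_; _≤ᵇ_; _+_)
open import Data.Fin using (Fin)
open import Data.Fin.Subset using (Subset; inside; outside; ∣_∣)
open import Data.Fin.Subset.Properties using (_⊂?_)
open import Data.Fin.Permutation using (Permutation′; _⟨$⟩ʳ_; _⟨$⟩ˡ_)
open import Data.List using (List; []; _∷_; map; _++_; filter; length; foldr)
open import Data.List.Membership.Propositional using (_∈_)
import Data.List.Membership.DecPropositional as DecMem
open import Data.Vec using (Vec; []; _∷_; lookup; tabulate)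
open import Data.Vec.Properties using (≡-dec)
import Data.Bool.Properties as BoolP
open import Data.Rational using (ℚ; 0ℚ; 1ℚ; ½; _*_)
open import Data.Product using (_×_)
open import Relation.Nullary using (Dec; yes; no; does)
open import Relation.Unary using (Decidable)
open import Relation.Binary.PropositionalEquality using (_≡_)
open import Function.Bundles using (_⇔_)

-- By General Irreflexivity and Symmetry, S_n (n ≥ 1) is determined by
-- the set of (n+1)-element subsets on which it holds.  We represent a
-- structure in K_SC^N by the list F of its faces, i.e. subsets of Fin N
-- of size ≥ 2 on which the appropriate relation holds (vertices are
-- implicit: every element is a vertex).

Faces : ℕ → Set
Faces N = List (Subset N)

subsets : (n : ℕ) → List (Subset n)
subsets zero    = [] ∷ []
subsets (suc n) = map (inside ∷_) (subsets n) ++ map (outside ∷_) (subsets n)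

allᵇ : {A : Set} → (A → Bool) → List A → Bool
allᵇ p = foldr (λ x b → p x ∧ b) true

sublists : {A : Set} → List A → List (List A)
sublists []       = [] ∷ []
sublists (x ∷ xs) = map (x ∷_) (sublists xs) ++ sublists xs

_∈ᵇ_ : {N : ℕ} → Subset N → Faces N → Bool
_∈ᵇ_ {N} X F = does (DecMem._∈?_ (≡-dec BoolP._≟_) X F)

-- X (of size k) is a candidate simplex w.r.t. F: all proper subsets of X
-- of size ≥ 2 are faces of F.
candidate : {N : ℕ} → Faces N → Subset N → Bool
candidate {N} F X =
  allᵇ (λ Y → not (does (Y ⊂? X) ∧ (2 ≤ᵇ ∣ Y ∣)) ∨ (Y ∈ᵇ F)) (subsets N)

candidates : {N : ℕ} → ℕ → Faces N → List (Subset N)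
candidates {N} k F =
  filter (λ X → Data.Nat._≟_ ∣ X ∣ k) (filter (λ X → BoolP.T? (candidate F X)) (subsets N))
  where import Data.Nat

halfPow : ℕ → ℚ
halfPow zero    = 1ℚ
halfPow (suc n) = ½ * halfPow n

sumℚ : List ℚ → ℚ
sumℚ = foldr Data.Rational._+_ 0ℚ
  where import Data.Rational

-- Frame-wise uniform measure, built dimension by dimension:
-- at stage k (faces of size k, i.e. the relation S_{k-1}), each candidate
-- simplex is included independently with probability 1/2, i.e. each
-- choice C of a subcollection of the candidates has probability
-- 2^{-#candidates}.  'fuel' counts the remaining stages; k runs 2..N.
module _ {N : ℕ} {P : Faces N → Set} (P? : Decidable P) where
  measureFrom : (fuel k : ℕ) → Faces N → ℚ
  measureFrom zero k F = if does (P? F) then 1ℚ else 0ℚ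
  measureFrom (suc fuel) k F =
    let cs = candidates k F in
    sumℚ (map (λ C → halfPow (length cs) * measureFrom fuel (suc k) (F ++ C)) (sublists cs))

μ : (N : ℕ) {P : Faces N → Set} → Decidable P → ℚ
μ N P? = measureFrom P? (N ∸ 1) 2 []

image : {N : ℕ} → Permutation′ N → Subset N → Subset N
image π X = tabulate (λ j → lookup X (π ⟨$⟩ˡ j))

IsAutomorphism : {N : ℕ} → Faces N → Permutation′ N → Set
IsAutomorphism {N} F π = (X : Subset N) → (X ∈ F) ⇔ (image π X ∈ F)

TrivialAut : {N : ℕ} → Faces N → Set
TrivialAut {N} F = (π : Permutation′ N) → IsAutomorphism F π → (i : Fin N) → π ⟨$⟩ʳ i ≡ i

-- A complex is rigid as soon as its 1-skeleton is: every automorphism of the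
-- complex preserves its edges, and the faces of dimension ≥ 2 are added on top
-- of the graph chosen in the first round, which is a uniformly random graph on
-- N vertices.  So it suffices that the random graph is rigid with probability
-- tending to 1.  A nontrivial edge-preserving permutation π is caught by one
-- of polynomially many witnesses, each a list of disjoint pairs of possible
-- edges that must agree (both present or both absent): if π moves at most 3r
-- vertices, then a moved vertex i and π i have the same neighbours among the
-- N − 3r fixed vertices; otherwise there are r moved vertices I with π I
-- disjoint from I, and π maps the r (N − 2r) edges between I and the vertices
-- outside I ∪ π I onto other edges.  Agreement on K disjoint pairs has
-- probability 2^−K, and for large N, taking r = 2 ⌈log₂ N⌉ + 1 makes the union
-- bound over all witnesses at most 1 / N.

module Submission where

open import Defs
open import Algebra.Bundles using (CommutativeMonoid)
open import Data.Bool using (Bool; true; false; _∧_; _∨_; not; _xor_; if_then_else_; T)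
open import Data.Bool.Properties
  using (not-involutive; xor-comm; ∧-identityʳ; ∧-commutativeMonoid; ∨-comm) renaming (_≟_ to _≟ᵇ_)
open import Algebra.Properties.CommutativeSemigroup
  (CommutativeMonoid.commutativeSemigroup ∧-commutativeMonoid) using () renaming (x∙yz≈y∙xz to ∧-lcomm)
open import Data.Empty using (⊥; ⊥-elim)
open import Data.Fin using (Fin; zero; suc; _≟_)
open import Data.Fin.Permutation using (Permutation′; _⟨$⟩ʳ_; _⟨$⟩ˡ_; inverseˡ; inverseʳ)
open import Data.Fin.Subset using (Subset) renaming (∣_∣ to ∣_∣ˢ)
open import Data.Fin.Subset.Properties using (_⊂?_; p⊂q⇒∣p∣<∣q∣)
import Data.Integer as ℤ
import Data.Integer.Properties as ℤ
open import Data.List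
  using (List; []; _∷_; map; _++_; length; filter; allFin; cartesianProduct; cartesianProductWith; replicate)
open import Data.List.Properties using (length-map; length-++; length-tabulate; length-replicate; filter-all)
open import Data.List.Membership.Propositional using (_∈_; _∉_; lose)
open import Data.List.Membership.Propositional.Properties
  using (∈-allFin; ∈-map⁺; ∈-map⁻; ∈-filter⁺; ∈-filter⁻; ∈-++⁺ˡ; ∈-++⁺ʳ; ∈-++⁻;
         ∈-cartesianProductWith⁺; ∈-cartesianProduct⁺; ∈-cartesianProduct⁻)
open import Data.List.Relation.Binary.Permutation.Propositional
  using (_↭_; prep; swap; ↭-refl; ↭-trans; ↭-sym; ↭⇒↭ₛ)
open import Data.List.Relation.Binary.Permutation.Propositional.Properties using (shift; ∈-resp-↭)
open import Data.List.Relation.Binary.Subset.Propositional using (_⊆_)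
open import Data.List.Relation.Binary.Subset.Propositional.Properties using (∷⁺ʳ; xs⊆x∷xs; ⊆-trans; ⊆∷∧∉⇒⊆)
open import Data.List.Relation.Unary.All as All using (All; []; _∷_)
import Data.List.Relation.Unary.All.Properties as All
open import Data.List.Relation.Unary.Any using (Any; here; there; any?)
import Data.List.Relation.Unary.Any.Properties as Any
import Data.List.Relation.Unary.Unique.Propositional as Unique
open Unique using (Unique; []; _∷_)
import Data.List.Relation.Unary.Unique.Propositional.Properties as Unique
open import Data.List.Relation.Unary.Unique.Propositional.Properties using (Unique[x∷xs]⇒x∉xs)
open import Data.Nat as ℕ using (ℕ; zero; suc; pred; _∸_; _^_; _≥_; _≤ᵇ_)
import Data.Nat.Properties as ℕ
open import Data.Product using (_×_; _,_; proj₁; proj₂; ∃₂; ∃-syntax)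
import Data.Product
open import Data.Rational using (ℚ; mkℚ; *<*; 0ℚ; 1ℚ; ½; _+_; _*_; _-_; -_; _≤_; _<_; ∣_∣; toℚᵘ)
import Data.Rational.Properties as ℚ
open import Algebra.Properties.Monoid.Mult ℚ.+-0-monoid using (×-assocˡ) renaming (_×_ to _×ℚ_)
open import Data.Rational.Unnormalised as ℚᵘ using (mkℚᵘ)
import Data.Rational.Unnormalised.Properties as ℚᵘ
open import Data.Sum using (_⊎_; inj₁; inj₂)
open import Data.Vec using (Vec; []; _∷_; toList; fromList; lookup; tabulate)
open import Data.Vec.Properties using (toList∘fromList; lookup∘tabulate; tabulate-cong; ∷-injectiveʳ; ≡-dec)
open import Function using (_∘_; id; const; _⇔_; mk⇔; Equivalence)
open import Function.Properties.Equivalence using (⇔-setoid)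
open import Level using (0ℓ)
open import Relation.Binary.Definitions using (DecidableEquality)
open import Relation.Binary.PropositionalEquality
open import Relation.Nullary using (Dec; yes; no; does; ¬_; ¬?; _×-dec_)
open import Relation.Nullary.Decidable using (dec-true; dec-false; T?; does-⇔)
open import Relation.Unary using (Decidable)

sumℚ-map-++ : {A : Set} (f : A → ℚ) (xs ys : List A) →
              sumℚ (map f (xs ++ ys)) ≡ sumℚ (map f xs) + sumℚ (map f ys)
sumℚ-map-++ f []       ys = sym (ℚ.+-identityˡ (sumℚ (map f ys)))
sumℚ-map-++ f (x ∷ xs) ys = trans (cong (f x +_) (sumℚ-map-++ f xs ys))
                                  (sym (ℚ.+-assoc (f x) (sumℚ (map f xs)) (sumℚ (map f ys))))

sumℚ-mono : {A : Set} {f g : A → ℚ} (xs : List A) → (∀ x → f x ≤ g x) →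
            sumℚ (map f xs) ≤ sumℚ (map g xs)
sumℚ-mono []       f≤g = ℚ.≤-refl
sumℚ-mono (x ∷ xs) f≤g = ℚ.+-mono-≤ (f≤g x) (sumℚ-mono xs f≤g)

sumℚ-map-const : {A : Set} (q : ℚ) (xs : List A) → sumℚ (map (const q) xs) ≡ length xs ×ℚ q
sumℚ-map-const q []       = refl
sumℚ-map-const q (x ∷ xs) = cong (q +_) (sumℚ-map-const q xs)

weightedSum : {A : Set} → ℚ → List A → (A → ℚ) → ℚ
weightedSum w xs f = sumℚ (map (λ x → w * f x) xs)

weightedSum-map : {A B : Set} (w : ℚ) (g : A → B) (xs : List A) (f : B → ℚ) →
                  weightedSum w (map g xs) f ≡ weightedSum w xs (f ∘ g)
weightedSum-map w g []       f = refl
weightedSum-map w g (x ∷ xs) f = cong (w * f (g x) +_) (weightedSum-map w g xs f)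

weightedSum-*ˡ : {A : Set} (a w : ℚ) (xs : List A) (f : A → ℚ) →
                 weightedSum (a * w) xs f ≡ a * weightedSum w xs f
weightedSum-*ˡ a w []       f = sym (ℚ.*-zeroʳ a)
weightedSum-*ˡ a w (x ∷ xs) f = begin
  a * w * f x + weightedSum (a * w) xs f ≡⟨ cong₂ _+_ (ℚ.*-assoc a w (f x)) (weightedSum-*ˡ a w xs f) ⟩
  a * (w * f x) + a * weightedSum w xs f ≡⟨ ℚ.*-distribˡ-+ a (w * f x) (weightedSum w xs f) ⟨
  a * weightedSum w (x ∷ xs) f           ∎
  where open ≡-Reasoning

q≤p+q : {p : ℚ} (q : ℚ) → 0ℚ ≤ p → q ≤ p + q
q≤p+q {p} q 0≤p = subst (_≤ p + q) (ℚ.+-identityˡ q) (ℚ.+-monoˡ-≤ q 0≤p)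

p≤p+q : (p : ℚ) {q : ℚ} → 0ℚ ≤ q → p ≤ p + q
p≤p+q p {q} 0≤q = subst (_≤ p + q) (ℚ.+-identityʳ p) (ℚ.+-monoʳ-≤ p 0≤q)

×ℚ-monoˡ-≤ : {m n : ℕ} {q : ℚ} → m ℕ.≤ n → 0ℚ ≤ q → m ×ℚ q ≤ n ×ℚ q
×ℚ-monoˡ-≤ {n = n} {q} ℕ.z≤n       0≤q = 0≤n×ℚq n
  where
  0≤n×ℚq : (n : ℕ) → 0ℚ ≤ n ×ℚ q
  0≤n×ℚq zero    = ℚ.≤-refl
  0≤n×ℚq (suc n) = ℚ.≤-trans (0≤n×ℚq n) (q≤p+q (n ×ℚ q) 0≤q)
×ℚ-monoˡ-≤ {q = q} (ℕ.s≤s m≤n) 0≤q = ℚ.+-monoʳ-≤ q (×ℚ-monoˡ-≤ m≤n 0≤q)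

×ℚ-monoʳ-≤ : (n : ℕ) {p q : ℚ} → p ≤ q → n ×ℚ p ≤ n ×ℚ q
×ℚ-monoʳ-≤ zero    p≤q = ℚ.≤-refl
×ℚ-monoʳ-≤ (suc n) p≤q = ℚ.+-mono-≤ p≤q (×ℚ-monoʳ-≤ n p≤q)

½*[q+q]≡q : (q : ℚ) → ½ * (q + q) ≡ q
½*[q+q]≡q q = begin
  ½ * (q + q)               ≡⟨ cong (½ *_) (cong₂ _+_ (ℚ.*-identityˡ q) (ℚ.*-identityˡ q)) ⟨
  ½ * (1ℚ * q + 1ℚ * q)     ≡⟨ cong (½ *_) (ℚ.*-distribʳ-+ q 1ℚ 1ℚ) ⟨
  ½ * ((1ℚ + 1ℚ) * q)       ≡⟨ ℚ.*-assoc ½ (1ℚ + 1ℚ) q ⟨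
  1ℚ * q                    ≡⟨ ℚ.*-identityˡ q ⟩
  q                         ∎
  where open ≡-Reasoning

halfPow-suc+halfPow-suc : (n : ℕ) → halfPow (suc n) + halfPow (suc n) ≡ halfPow n
halfPow-suc+halfPow-suc n = trans (sym (ℚ.*-distribˡ-+ ½ (halfPow n) (halfPow n))) (½*[q+q]≡q (halfPow n))

0≤halfPow : (n : ℕ) → 0ℚ ≤ halfPow n
0≤halfPow zero    = ℚ.nonNegative⁻¹ 1ℚ
0≤halfPow (suc n) = subst (_≤ halfPow (suc n)) (ℚ.*-zeroʳ ½) (ℚ.*-monoˡ-≤-nonNeg ½ (0≤halfPow n))

halfPow≤1 : (n : ℕ) → halfPow n ≤ 1ℚ
halfPow≤1 zero    = ℚ.≤-refl
halfPow≤1 (suc n) = ℚ.≤-trans (ℚ.*-monoˡ-≤-nonNeg ½ (halfPow≤1 n)) (ℚ.≤ᵇ⇒≤ _)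

halfPow-antitone : {m n : ℕ} → m ℕ.≤ n → halfPow n ≤ halfPow m
halfPow-antitone {n = n} ℕ.z≤n = halfPow≤1 n
halfPow-antitone (ℕ.s≤s m≤n)   = ℚ.*-monoˡ-≤-nonNeg ½ (halfPow-antitone m≤n)

2^d×halfPow[d+n] : (d n : ℕ) → (2 ^ d) ×ℚ halfPow (d ℕ.+ n) ≡ halfPow n
2^d×halfPow[d+n] zero    n = ℚ.+-identityʳ (halfPow n)
2^d×halfPow[d+n] (suc d) n = begin
  (2 ℕ.* 2 ^ d) ×ℚ halfPow (suc d ℕ.+ n)   ≡⟨ cong (λ m → (2 ℕ.* 2 ^ d) ×ℚ halfPow m) (ℕ.+-suc d n) ⟨
  (2 ℕ.* 2 ^ d) ×ℚ halfPow (d ℕ.+ suc n)   ≡⟨ ×-assocˡ (halfPow (d ℕ.+ suc n)) 2 (2 ^ d) ⟨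
  2 ×ℚ ((2 ^ d) ×ℚ halfPow (d ℕ.+ suc n))  ≡⟨ cong (2 ×ℚ_) (2^d×halfPow[d+n] d (suc n)) ⟩
  halfPow (suc n) + (halfPow (suc n) + 0ℚ) ≡⟨ cong (halfPow (suc n) +_) (ℚ.+-identityʳ (halfPow (suc n))) ⟩
  halfPow (suc n) + halfPow (suc n)        ≡⟨ halfPow-suc+halfPow-suc n ⟩
  halfPow n                                ∎
  where open ≡-Reasoning

×ℚ-halfPow-≤ : {m d n K : ℕ} → m ℕ.≤ 2 ^ d → d ℕ.+ n ℕ.≤ K → m ×ℚ halfPow K ≤ halfPow n
×ℚ-halfPow-≤ {m} {d} {n} {K} m≤2^d d+n≤K = begin
  m ×ℚ halfPow K                 ≤⟨ ×ℚ-monoˡ-≤ m≤2^d (0≤halfPow K) ⟩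
  (2 ^ d) ×ℚ halfPow K           ≤⟨ ×ℚ-monoʳ-≤ (2 ^ d) (halfPow-antitone d+n≤K) ⟩
  (2 ^ d) ×ℚ halfPow (d ℕ.+ n)   ≡⟨ 2^d×halfPow[d+n] d n ⟩
  halfPow n                      ∎
  where open ℚ.≤-Reasoning

-- Expectation over a random sub-collection

-- By definition, measureFrom P? (suc fuel) k F is
-- 𝔼 (candidates k F) (λ D → measureFrom P? fuel (suc k) (F ++ D)).
𝔼 : {A : Set} → List A → (List A → ℚ) → ℚ
𝔼 xs = weightedSum (halfPow (length xs)) (sublists xs)

module _ {A : Set} where

  𝔼-[] : (f : List A → ℚ) → 𝔼 [] f ≡ f []
  𝔼-[] f = trans (ℚ.+-identityʳ (1ℚ * f [])) (ℚ.*-identityˡ (f []))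

  𝔼-∷ : (x : A) (xs : List A) (f : List A → ℚ) →
        𝔼 (x ∷ xs) f ≡ ½ * (𝔼 xs (f ∘ (x ∷_)) + 𝔼 xs f)
  𝔼-∷ x xs f = begin
    weightedSum (½ * w) (map (x ∷_) S ++ S) f
      ≡⟨ sumℚ-map-++ (λ C → ½ * w * f C) (map (x ∷_) S) S ⟩
    weightedSum (½ * w) (map (x ∷_) S) f + weightedSum (½ * w) S f
      ≡⟨ cong (_+ weightedSum (½ * w) S f) (weightedSum-map (½ * w) (x ∷_) S f) ⟩
    weightedSum (½ * w) S (f ∘ (x ∷_)) + weightedSum (½ * w) S f
      ≡⟨ cong₂ _+_ (weightedSum-*ˡ ½ w S (f ∘ (x ∷_))) (weightedSum-*ˡ ½ w S f) ⟩
    ½ * 𝔼 xs (f ∘ (x ∷_)) + ½ * 𝔼 xs f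
      ≡⟨ ℚ.*-distribˡ-+ ½ (𝔼 xs (f ∘ (x ∷_))) (𝔼 xs f) ⟨
    ½ * (𝔼 xs (f ∘ (x ∷_)) + 𝔼 xs f) ∎
    where
    open ≡-Reasoning
    w = halfPow (length xs)
    S = sublists xs

  𝔼-mono : (xs : List A) {f g : List A → ℚ} →
           (∀ C → C ⊆ xs → f C ≤ g C) → 𝔼 xs f ≤ 𝔼 xs g
  𝔼-mono []       {f} {g} f≤g = subst₂ _≤_ (sym (𝔼-[] f)) (sym (𝔼-[] g)) (f≤g [] (λ ()))
  𝔼-mono (x ∷ xs) {f} {g} f≤g = subst₂ _≤_ (sym (𝔼-∷ x xs f)) (sym (𝔼-∷ x xs g))
    (ℚ.*-monoˡ-≤-nonNeg ½ (ℚ.+-mono-≤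
      (𝔼-mono xs (λ C C⊆xs → f≤g (x ∷ C) (∷⁺ʳ x C⊆xs)))
      (𝔼-mono xs (λ C C⊆xs → f≤g C (⊆-trans C⊆xs (xs⊆x∷xs xs x))))))

  𝔼-cong : (xs : List A) {f g : List A → ℚ} →
           (∀ C → C ⊆ xs → f C ≡ g C) → 𝔼 xs f ≡ 𝔼 xs g
  𝔼-cong xs f≗g = ℚ.≤-antisym (𝔼-mono xs (λ C C⊆xs → ℚ.≤-reflexive (f≗g C C⊆xs)))
                               (𝔼-mono xs (λ C C⊆xs → ℚ.≤-reflexive (sym (f≗g C C⊆xs))))

  𝔼-∷-ignored : (x : A) (xs : List A) (f : List A → ℚ) → (∀ C → f (x ∷ C) ≡ f C) →
                𝔼 (x ∷ xs) f ≡ 𝔼 xs f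
  𝔼-∷-ignored x xs f ignored = begin
    𝔼 (x ∷ xs) f                     ≡⟨ 𝔼-∷ x xs f ⟩
    ½ * (𝔼 xs (f ∘ (x ∷_)) + 𝔼 xs f) ≡⟨ cong (λ e → ½ * (e + 𝔼 xs f)) (𝔼-cong xs (λ C _ → ignored C)) ⟩
    ½ * (𝔼 xs f + 𝔼 xs f)            ≡⟨ ½*[q+q]≡q (𝔼 xs f) ⟩
    𝔼 xs f                           ∎
    where open ≡-Reasoning

  𝔼-const : (xs : List A) (q : ℚ) → 𝔼 xs (const q) ≡ q
  𝔼-const []       q = 𝔼-[] (const q)
  𝔼-const (x ∷ xs) q = trans (𝔼-∷-ignored x xs (const q) (λ _ → refl)) (𝔼-const xs q)

  𝔼-+ : (xs : List A) (f g : List A → ℚ) → 𝔼 xs (λ C → f C + g C) ≡ 𝔼 xs f + 𝔼 xs g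
  𝔼-+ []       f g = trans (𝔼-[] (λ C → f C + g C)) (sym (cong₂ _+_ (𝔼-[] f) (𝔼-[] g)))
  𝔼-+ (x ∷ xs) f g = begin
    𝔼 (x ∷ xs) (λ C → f C + g C)
      ≡⟨ 𝔼-∷ x xs (λ C → f C + g C) ⟩
    ½ * (𝔼 xs (λ C → f (x ∷ C) + g (x ∷ C)) + 𝔼 xs (λ C → f C + g C))
      ≡⟨ cong₂ (λ a b → ½ * (a + b)) (𝔼-+ xs (f ∘ (x ∷_)) (g ∘ (x ∷_))) (𝔼-+ xs f g) ⟩
    ½ * ((a + b) + (c + d))
      ≡⟨ cong (½ *_) (+-interchange a b c d) ⟩
    ½ * ((a + c) + (b + d))
      ≡⟨ ℚ.*-distribˡ-+ ½ (a + c) (b + d) ⟩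
    ½ * (a + c) + ½ * (b + d)
      ≡⟨ cong₂ _+_ (𝔼-∷ x xs f) (𝔼-∷ x xs g) ⟨
    𝔼 (x ∷ xs) f + 𝔼 (x ∷ xs) g ∎
    where
    open ≡-Reasoning
    open import Data.Rational.Solver using (module +-*-Solver)
    open +-*-Solver
    a = 𝔼 xs (f ∘ (x ∷_))
    b = 𝔼 xs (g ∘ (x ∷_))
    c = 𝔼 xs f
    d = 𝔼 xs g
    +-interchange : (a b c d : ℚ) → (a + b) + (c + d) ≡ (a + c) + (b + d)
    +-interchange = solve 4 (λ a b c d → (a :+ b) :+ (c :+ d) := (a :+ c) :+ (b :+ d)) refl

  𝔼-sum : {B : Set} (xs : List A) (bs : List B) (f : B → List A → ℚ) →
          𝔼 xs (λ C → sumℚ (map (λ b → f b C) bs)) ≡ sumℚ (map (λ b → 𝔼 xs (f b)) bs)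
  𝔼-sum xs []       f = 𝔼-const xs 0ℚ
  𝔼-sum xs (b ∷ bs) f = trans (𝔼-+ xs (f b) (λ C → sumℚ (map (λ b → f b C) bs)))
                              (cong (𝔼 xs (f b) +_) (𝔼-sum xs bs f))

𝟙 : Bool → ℚ
𝟙 b = if b then 1ℚ else 0ℚ

0≤𝟙 : (b : Bool) → 0ℚ ≤ 𝟙 b
0≤𝟙 true  = ℚ.nonNegative⁻¹ 1ℚ
0≤𝟙 false = ℚ.≤-refl

𝟙≤1 : (b : Bool) → 𝟙 b ≤ 1ℚ
𝟙≤1 true  = ℚ.≤-refl
𝟙≤1 false = ℚ.nonNegative⁻¹ 1ℚ

𝟙[b∧e]+𝟙[¬b∧e] : (b e : Bool) → 𝟙 (b ∧ e) + 𝟙 (not b ∧ e) ≡ 𝟙 e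
𝟙[b∧e]+𝟙[¬b∧e] true  true  = refl
𝟙[b∧e]+𝟙[¬b∧e] true  false = refl
𝟙[b∧e]+𝟙[¬b∧e] false true  = refl
𝟙[b∧e]+𝟙[¬b∧e] false false = refl

𝔼-∷-𝟙-split : {A : Set} (x : A) (xs : List A) (f : List A → ℚ) (b e : List A → Bool) →
              (∀ C → C ⊆ xs → f (x ∷ C) ≡ 𝟙 (b C ∧ e C)) →
              (∀ C → C ⊆ xs → f C ≡ 𝟙 (not (b C) ∧ e C)) →
              𝔼 (x ∷ xs) f ≡ ½ * 𝔼 xs (𝟙 ∘ e)
𝔼-∷-𝟙-split x xs f b e with-x without-x = begin
  𝔼 (x ∷ xs) f
    ≡⟨ 𝔼-∷ x xs f ⟩
  ½ * (𝔼 xs (f ∘ (x ∷_)) + 𝔼 xs f)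
    ≡⟨ cong₂ (λ p q → ½ * (p + q)) (𝔼-cong xs with-x) (𝔼-cong xs without-x) ⟩
  ½ * (𝔼 xs (λ C → 𝟙 (b C ∧ e C)) + 𝔼 xs (λ C → 𝟙 (not (b C) ∧ e C)))
    ≡⟨ cong (½ *_) (𝔼-+ xs (λ C → 𝟙 (b C ∧ e C)) (λ C → 𝟙 (not (b C) ∧ e C))) ⟨
  ½ * 𝔼 xs (λ C → 𝟙 (b C ∧ e C) + 𝟙 (not (b C) ∧ e C))
    ≡⟨ cong (½ *_) (𝔼-cong xs (λ C _ → 𝟙[b∧e]+𝟙[¬b∧e] (b C) (e C))) ⟩
  ½ * 𝔼 xs (𝟙 ∘ e) ∎
  where open ≡-Reasoning

-- Agreement on disjoint pairs

endpoints : {A : Set} → List (A × A) → List A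
endpoints []             = []
endpoints ((a , b) ∷ ps) = a ∷ b ∷ endpoints ps

module _ {A B : Set} (P Q : B → A) where

  endpoints-map⁻ : (ks : List B) {y : A} → y ∈ endpoints (map (λ k → P k , Q k) ks) →
                   ∃[ k ] k ∈ ks × (y ≡ P k ⊎ y ≡ Q k)
  endpoints-map⁻ (k ∷ ks) (here y≡Pk)         = k , here refl , inj₁ y≡Pk
  endpoints-map⁻ (k ∷ ks) (there (here y≡Qk)) = k , here refl , inj₂ y≡Qk
  endpoints-map⁻ (k ∷ ks) (there (there y∈))  with endpoints-map⁻ ks y∈
  ... | k′ , k′∈ , y≡ = k′ , there k′∈ , y≡

  endpoints-map-unique : (ks : List B) → Unique ks →
    (∀ {k k′} → k ∈ ks → k′ ∈ ks → P k ≡ P k′ → k ≡ k′) →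
    (∀ {k k′} → k ∈ ks → k′ ∈ ks → Q k ≡ Q k′ → k ≡ k′) →
    (∀ {k k′} → k ∈ ks → k′ ∈ ks → P k ≢ Q k′) →
    Unique (endpoints (map (λ k → P k , Q k) ks))
  endpoints-map-unique []       _            _     _     _   = []
  endpoints-map-unique (k ∷ ks) (k∉ks ∷ !ks) P-inj Q-inj P≢Q =
    (P≢Q (here refl) (here refl) ∷ All.tabulate P-fresh) ∷ All.tabulate Q-fresh ∷
    endpoints-map-unique ks !ks (λ m m′ → P-inj (there m) (there m′))
                                (λ m m′ → Q-inj (there m) (there m′))
                                (λ m m′ → P≢Q (there m) (there m′))
    where
    k≢ : ∀ {k′} → k′ ∈ ks → k ≢ k′
    k≢ = All.lookup k∉ks
    P-fresh : ∀ {y} → y ∈ endpoints (map (λ k → P k , Q k) ks) → P k ≢ y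
    P-fresh y∈ Pk≡y with endpoints-map⁻ ks y∈
    ... | k′ , k′∈ , inj₁ y≡Pk′ = k≢ k′∈ (P-inj (here refl) (there k′∈) (trans Pk≡y y≡Pk′))
    ... | k′ , k′∈ , inj₂ y≡Qk′ = P≢Q (here refl) (there k′∈) (trans Pk≡y y≡Qk′)
    Q-fresh : ∀ {y} → y ∈ endpoints (map (λ k → P k , Q k) ks) → Q k ≢ y
    Q-fresh y∈ Qk≡y with endpoints-map⁻ ks y∈
    ... | k′ , k′∈ , inj₁ y≡Pk′ = P≢Q (there k′∈) (here refl) (sym (trans Qk≡y y≡Pk′))
    ... | k′ , k′∈ , inj₂ y≡Qk′ = k≢ k′∈ (Q-inj (here refl) (there k′∈) (trans Qk≡y y≡Qk′))

module Agreement {A : Set} (_≟_ : DecidableEquality A) where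

  open import Data.List.Membership.DecPropositional _≟_ using (_∈?_)
  open import Data.List.Relation.Binary.Permutation.Setoid.Properties (setoid A) using (Unique-resp-↭)

  sameᵇ : A → A → List A → Bool
  sameᵇ a b C = not (does (a ∈? C) xor does (b ∈? C))

  agreeᵇ : List (A × A) → List A → Bool
  agreeᵇ ps C = allᵇ (λ (a , b) → sameᵇ a b C) ps

  ∈?-∷-≢ : {a x : A} (C : List A) → a ≢ x → does (a ∈? (x ∷ C)) ≡ does (a ∈? C)
  ∈?-∷-≢ {a} {x} C a≢x with a ≟ x
  ... | yes a≡x = ⊥-elim (a≢x a≡x)
  ... | no  _   = refl

  sameᵇ-head : {x b : A} (C : List A) → x ≢ b → sameᵇ x b (x ∷ C) ≡ does (b ∈? C)
  sameᵇ-head {x} {b} C x≢b rewrite dec-true (x ≟ x) refl | ∈?-∷-≢ C (x≢b ∘ sym) =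
    not-involutive (does (b ∈? C))

  sameᵇ-absent : {x : A} {C : List A} (b : A) → x ∉ C → sameᵇ x b C ≡ not (does (b ∈? C))
  sameᵇ-absent {x} {C} b x∉C rewrite dec-false (x ∈? C) x∉C = refl

  agreeᵇ-fresh : (x : A) (ps : List (A × A)) (C : List A) →
                 x ∉ endpoints ps → agreeᵇ ps (x ∷ C) ≡ agreeᵇ ps C
  agreeᵇ-fresh x []             C x∉ = refl
  agreeᵇ-fresh x ((a , b) ∷ ps) C x∉
    rewrite ∈?-∷-≢ C (λ a≡x → x∉ (here (sym a≡x)))
          | ∈?-∷-≢ C (λ b≡x → x∉ (there (here (sym b≡x))))
          | agreeᵇ-fresh x ps C (x∉ ∘ there ∘ there) = refl

  agreeᵇ-intro : (ps : List (A × A)) (C : List A) →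
                 All (λ (a , b) → a ∈ C ⇔ b ∈ C) ps → agreeᵇ ps C ≡ true
  agreeᵇ-intro []             C []               = refl
  agreeᵇ-intro ((a , b) ∷ ps) C (a⇔b ∷ ps-agree)
    rewrite agreeᵇ-intro ps C ps-agree | ∧-identityʳ (sameᵇ a b C)
    with a ∈? C | b ∈? C
  ... | yes _   | yes _   = refl
  ... | no  _   | no  _   = refl
  ... | yes a∈C | no  b∉C = ⊥-elim (b∉C (Equivalence.to a⇔b a∈C))
  ... | no  a∉C | yes b∈C = ⊥-elim (a∉C (Equivalence.from a⇔b b∈C))

  extract-pair : (x : A) (ps : List (A × A)) → x ∈ endpoints ps →
    ∃₂ λ b ps′ → endpoints ps ↭ x ∷ b ∷ endpoints ps′
               × length ps ≡ suc (length ps′)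
               × (∀ C → agreeᵇ ps C ≡ sameᵇ x b C ∧ agreeᵇ ps′ C)
  extract-pair x ((a , c) ∷ ps) (here refl) = c , ps , ↭-refl , refl , λ C → refl
  extract-pair x ((a , c) ∷ ps) (there (here refl)) =
    a , ps , swap a c ↭-refl , refl ,
    λ C → cong (λ s → not s ∧ agreeᵇ ps C) (xor-comm (does (a ∈? C)) (does (c ∈? C)))
  extract-pair x ((a , c) ∷ ps) (there (there x∈)) with extract-pair x ps x∈
  ... | b , ps′ , σ , len , split =
    b , (a , c) ∷ ps′ , σ′ , cong suc len ,
    λ C → trans (cong (sameᵇ a c C ∧_) (split C)) (∧-lcomm (sameᵇ a c C) (sameᵇ x b C) (agreeᵇ ps′ C))
    where
    E′ = endpoints ps′
    σ′ : a ∷ c ∷ endpoints ps ↭ x ∷ b ∷ a ∷ c ∷ E′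
    σ′ = ↭-trans (prep a (prep c σ))
        (↭-trans (shift x (a ∷ c ∷ []) (b ∷ E′)) (prep x (shift b (a ∷ c ∷ []) E′)))

  -- Agreements on disjoint pairs are independent events of probability ½ each.
  𝔼-agree : (xs : List A) (ps : List (A × A)) →
            Unique xs → Unique (endpoints ps) → endpoints ps ⊆ xs →
            𝔼 xs (𝟙 ∘ agreeᵇ ps) ≡ halfPow (length ps)
  𝔼-agree [] []             _ _ _    = 𝔼-[] (𝟙 ∘ agreeᵇ [])
  𝔼-agree [] ((a , b) ∷ ps) _ _ E⊆[] with () ← E⊆[] (here refl)
  𝔼-agree (x ∷ xs) ps !x∷xs !E E⊆ with x ∈? endpoints ps
  ... | no x∉E =
    trans (𝔼-∷-ignored x xs (𝟙 ∘ agreeᵇ ps) (λ C → cong 𝟙 (agreeᵇ-fresh x ps C x∉E)))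
          (𝔼-agree xs ps (Unique.tail !x∷xs) !E (⊆∷∧∉⇒⊆ E⊆ x∉E))
  ... | yes x∈E with extract-pair x ps x∈E
  ... | b , ps′ , σ , len , split = begin
    𝔼 (x ∷ xs) (𝟙 ∘ agreeᵇ ps)
      ≡⟨ 𝔼-∷-𝟙-split x xs (𝟙 ∘ agreeᵇ ps) b∈ (agreeᵇ ps′) (λ C _ → cong 𝟙 (with-x C))
                                                           (λ C C⊆xs → cong 𝟙 (without-x C C⊆xs)) ⟩
    ½ * 𝔼 xs (𝟙 ∘ agreeᵇ ps′)
      ≡⟨ cong (½ *_) (𝔼-agree xs ps′ (Unique.tail !x∷xs) !E′ E′⊆xs) ⟩
    halfPow (suc (length ps′))
      ≡⟨ cong halfPow len ⟨
    halfPow (length ps) ∎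
    where
    open ≡-Reasoning
    b∈ : List A → Bool
    b∈ C = does (b ∈? C)
    !x∷b∷E′ : Unique (x ∷ b ∷ endpoints ps′)
    !x∷b∷E′ = Unique-resp-↭ (↭⇒↭ₛ σ) !E
    x∉b∷E′ = Unique[x∷xs]⇒x∉xs !x∷b∷E′
    !E′ = Unique.tail (Unique.tail !x∷b∷E′)
    E′⊆xs : endpoints ps′ ⊆ xs
    E′⊆xs = ⊆∷∧∉⇒⊆ (λ y∈ → E⊆ (∈-resp-↭ (↭-sym σ) (there (there y∈)))) (x∉b∷E′ ∘ there)
    with-x : ∀ C → agreeᵇ ps (x ∷ C) ≡ b∈ C ∧ agreeᵇ ps′ C
    with-x C = trans (split (x ∷ C)) (cong₂ _∧_ (sameᵇ-head C (x∉b∷E′ ∘ here))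
                                                (agreeᵇ-fresh x ps′ C (x∉b∷E′ ∘ there)))
    without-x : ∀ C → C ⊆ xs → agreeᵇ ps C ≡ not (b∈ C) ∧ agreeᵇ ps′ C
    without-x C C⊆xs =
      trans (split C) (cong (_∧ agreeᵇ ps′ C) (sameᵇ-absent b (Unique[x∷xs]⇒x∉xs !x∷xs ∘ C⊆xs)))

module _ {A : Set} (_≟_ : DecidableEquality A) where

  open import Data.List.Membership.DecPropositional _≟_ using (_∈?_; _∉?_)

  filter-∉?-fresh : (y : A) (v xs : List A) → y ∉ xs → filter (_∉? (y ∷ v)) xs ≡ filter (_∉? v) xs
  filter-∉?-fresh y v []       _      = refl
  filter-∉?-fresh y v (x ∷ xs) y∉x∷xs with x ≟ y | x ∈? v
  ... | yes refl | _     = ⊥-elim (y∉x∷xs (here refl))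
  ... | no  _    | yes _ = filter-∉?-fresh y v xs (y∉x∷xs ∘ there)
  ... | no  _    | no  _ = cong (x ∷_) (filter-∉?-fresh y v xs (y∉x∷xs ∘ there))

  length-filter-∉?-∷ : (y : A) (v xs : List A) → Unique xs →
    length (filter (_∉? v) xs) ℕ.≤ suc (length (filter (_∉? (y ∷ v)) xs))
  length-filter-∉?-∷ y v []       _     = ℕ.z≤n
  length-filter-∉?-∷ y v (x ∷ xs) !x∷xs with x ≟ y | x ∈? v
  ... | yes _    | yes _ = length-filter-∉?-∷ y v xs (Unique.tail !x∷xs)
  ... | no  _    | yes _ = length-filter-∉?-∷ y v xs (Unique.tail !x∷xs)
  ... | no  _    | no  _ = ℕ.s≤s (length-filter-∉?-∷ y v xs (Unique.tail !x∷xs))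
  ... | yes refl | no  _ =
    ℕ.s≤s (ℕ.≤-reflexive (cong length (sym (filter-∉?-fresh x v xs (Unique[x∷xs]⇒x∉xs !x∷xs)))))

  length-filter-∉? : (v xs : List A) → Unique xs → length xs ∸ length v ℕ.≤ length (filter (_∉? v) xs)
  length-filter-∉? []      xs !xs =
    ℕ.≤-reflexive (cong length (sym (filter-all (_∉? []) {xs = xs} (All.tabulate λ _ ()))))
  length-filter-∉? (y ∷ v) xs !xs = begin
    length xs ∸ suc (length v)        ≡⟨ ℕ.pred[m∸n]≡m∸[1+n] (length xs) (length v) ⟨
    pred (length xs ∸ length v)       ≤⟨ ℕ.pred-mono-≤ (length-filter-∉? v xs !xs) ⟩
    pred (length (filter (_∉? v) xs)) ≤⟨ ℕ.pred-mono-≤ (length-filter-∉?-∷ y v xs !xs) ⟩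
    length (filter (_∉? (y ∷ v)) xs)  ∎
    where open ℕ.≤-Reasoning

length-cartesianProductWith : {A B C : Set} (f : A → B → C) (xs : List A) (ys : List B) →
  length (cartesianProductWith f xs ys) ≡ length xs ℕ.* length ys
length-cartesianProductWith f []       ys = refl
length-cartesianProductWith f (x ∷ xs) ys = begin
  length (map (f x) ys ++ cartesianProductWith f xs ys)
    ≡⟨ length-++ (map (f x) ys) ⟩
  length (map (f x) ys) ℕ.+ length (cartesianProductWith f xs ys)
    ≡⟨ cong₂ ℕ._+_ (length-map (f x) ys) (length-cartesianProductWith f xs ys) ⟩
  length ys ℕ.+ length xs ℕ.* length ys ∎
  where open ≡-Reasoning

module _ (N : ℕ) where

  open import Data.List.Membership.DecPropositional (_≟_ {N}) using (_∉?_)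

  length-allFin : length (allFin N) ≡ N
  length-allFin = length-tabulate id

  vectors : (n : ℕ) → List (Vec (Fin N) n)
  vectors zero    = [] ∷ []
  vectors (suc n) = cartesianProductWith _∷_ (allFin N) (vectors n)

  length-vectors : (n : ℕ) → length (vectors n) ≡ N ^ n
  length-vectors zero    = refl
  length-vectors (suc n) = trans (length-cartesianProductWith _∷_ (allFin N) (vectors n))
                                 (cong₂ ℕ._*_ length-allFin (length-vectors n))

  ∈-vectors : {n : ℕ} (v : Vec (Fin N) n) → v ∈ vectors n
  ∈-vectors []      = here refl
  ∈-vectors (x ∷ v) = ∈-cartesianProductWith⁺ _∷_ (∈-allFin x) (∈-vectors v)

  lists : ℕ → List (List (Fin N))
  lists n = map toList (vectors n)

  length-lists : (n : ℕ) → length (lists n) ≡ N ^ n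
  length-lists n = trans (length-map toList (vectors n)) (length-vectors n)

  ∈-lists : (l : List (Fin N)) → l ∈ lists (length l)
  ∈-lists l = subst (_∈ lists (length l)) (toList∘fromList l) (∈-map⁺ toList (∈-vectors (fromList l)))

  others : List (Fin N) → List (Fin N)
  others v = filter (_∉? v) (allFin N)

  ∈-others⁻ : {k : Fin N} (v : List (Fin N)) → k ∈ others v → k ∉ v
  ∈-others⁻ v k∈ = proj₂ (∈-filter⁻ (_∉? v) {xs = allFin N} k∈)

  others-unique : (v : List (Fin N)) → Unique (others v)
  others-unique v = Unique.filter⁺ (_∉? v) (Unique.allFin⁺ N)

  length-others : (v : List (Fin N)) → N ∸ length v ℕ.≤ length (others v)
  length-others v = subst (λ n → n ∸ length v ℕ.≤ length (others v)) length-allFin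
                          (length-filter-∉? _≟_ v (allFin N) (Unique.allFin⁺ N))

module _ {N : ℕ} (π : Permutation′ N) where

  open import Data.List.Membership.DecPropositional (_≟_ {N}) using (_∉?_)

  ⟨$⟩ʳ-injective : {a b : Fin N} → π ⟨$⟩ʳ a ≡ π ⟨$⟩ʳ b → a ≡ b
  ⟨$⟩ʳ-injective {a} {b} πa≡πb = trans (sym (inverseˡ π)) (trans (cong (π ⟨$⟩ˡ_) πa≡πb) (inverseˡ π))

  support : List (Fin N)
  support = filter (λ k → ¬? (π ⟨$⟩ʳ k ≟ k)) (allFin N)

  ∈-support⁺ : {k : Fin N} → π ⟨$⟩ʳ k ≢ k → k ∈ support
  ∈-support⁺ {k} πk≢k = ∈-filter⁺ (λ k → ¬? (π ⟨$⟩ʳ k ≟ k)) (∈-allFin k) πk≢k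

  support-unique : Unique support
  support-unique = Unique.filter⁺ (λ k → ¬? (π ⟨$⟩ʳ k ≟ k)) (Unique.allFin⁺ N)

  support-moved : All (λ k → π ⟨$⟩ʳ k ≢ k) support
  support-moved = All.all-filter (λ k → ¬? (π ⟨$⟩ʳ k ≟ k)) (allFin N)

  -- Greedy choice: taking i discards at most π i and π⁻¹ i from the rest.
  separated-points : (t : ℕ) (l : List (Fin N)) → Unique l → All (λ k → π ⟨$⟩ʳ k ≢ k) l →
    3 ℕ.* t ℕ.≤ length l →
    ∃[ I ] length I ≡ t × Unique I × I ⊆ l × (∀ {a b} → a ∈ I → b ∈ I → π ⟨$⟩ʳ a ≢ b)
  separated-points zero    l       _    _                _   = [] , refl , [] , (λ ()) , λ ()
  separated-points (suc t) []      _    _                ()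
  separated-points (suc t) (i ∷ l) !i∷l (πi≢i ∷ l-moved) 3t≤ =
    let I , len , !I , I⊆l′ , separated =
          separated-points t l′ (Unique.filter⁺ (_∉? near) (Unique.tail !i∷l))
                                (All.filter⁺ (_∉? near) {xs = l} l-moved) 3t≤l′
        I⊆l : I ⊆ l
        I⊆l = proj₁ ∘ ∈-filter⁻ (_∉? near) {xs = l} ∘ I⊆l′
        far : ∀ {a} → a ∈ I → a ∉ near
        far = proj₂ ∘ ∈-filter⁻ (_∉? near) {xs = l} ∘ I⊆l′
    in i ∷ I , cong suc len ,
       All.tabulate (λ a∈I i≡a → Unique[x∷xs]⇒x∉xs !i∷l (subst (_∈ l) (sym i≡a) (I⊆l a∈I))) ∷ !I ,
       ∷⁺ʳ i I⊆l ,
       λ { (here refl) (here refl) → πi≢i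
         ; (here refl) (there b∈I) πi≡b → far b∈I (here (sym πi≡b))
         ; (there a∈I) (here refl) πa≡i →
             far a∈I (there (here (trans (sym (inverseˡ π)) (cong (π ⟨$⟩ˡ_) πa≡i))))
         ; (there a∈I) (there b∈I) → separated a∈I b∈I }
    where
    near = (π ⟨$⟩ʳ i) ∷ (π ⟨$⟩ˡ i) ∷ []
    l′ = filter (_∉? near) l
    3t≤l′ : 3 ℕ.* t ℕ.≤ length l′
    3t≤l′ = ℕ.≤-trans (ℕ.m+n≤o⇒m≤o∸n (3 ℕ.* t) (subst (ℕ._≤ length l) (ℕ.+-comm 2 (3 ℕ.* t))
                         (ℕ.≤-pred (subst (ℕ._≤ suc (length l)) (ℕ.*-suc 3 t) 3t≤))))
                       (length-filter-∉? _≟_ near l (Unique.tail !i∷l))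

_≟ˢ_ : {N : ℕ} → DecidableEquality (Subset N)
_≟ˢ_ = ≡-dec _≟ᵇ_

subsets-complete : {N : ℕ} (X : Subset N) → X ∈ subsets N
subsets-complete []                  = here refl
subsets-complete {suc N} (true ∷ X)  = ∈-++⁺ˡ (∈-map⁺ (true ∷_) (subsets-complete X))
subsets-complete {suc N} (false ∷ X) =
  ∈-++⁺ʳ (map (true ∷_) (subsets N)) (∈-map⁺ (false ∷_) (subsets-complete X))

subsets-unique : (N : ℕ) → Unique (subsets N)
subsets-unique zero    = All.[] ∷ []
subsets-unique (suc N) = Unique.++⁺ (Unique.map⁺ ∷-injectiveʳ (subsets-unique N))
                                    (Unique.map⁺ ∷-injectiveʳ (subsets-unique N)) disjoint
  where
  disjoint : ∀ {X} → X ∈ map (true ∷_) (subsets N) × X ∈ map (false ∷_) (subsets N) → ⊥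
  disjoint (X∈₁ , X∈₂) with ∈-map⁻ (true ∷_) X∈₁ | ∈-map⁻ (false ∷_) X∈₂
  ... | _ , _ , refl | _ , _ , ()

candidates-unique : {N : ℕ} (k : ℕ) (F : Faces N) → Unique (candidates k F)
candidates-unique {N} k F =
  Unique.filter⁺ (λ X → ∣ X ∣ˢ ℕ.≟ k) (Unique.filter⁺ (λ X → T? (candidate F X)) (subsets-unique N))

∈-candidates⁻ : {N : ℕ} (k : ℕ) (F : Faces N) {X : Subset N} → X ∈ candidates k F → ∣ X ∣ˢ ≡ k
∈-candidates⁻ {N} k F X∈ =
  proj₂ (∈-filter⁻ (λ X → ∣ X ∣ˢ ℕ.≟ k) {xs = filter (λ X → T? (candidate F X)) (subsets N)} X∈)

edge : {N : ℕ} → Fin N → Fin N → Subset N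
edge a b = tabulate (λ j → does (j ≟ a) ∨ does (j ≟ b))

module _ {N : ℕ} where

  lookup-edge : (a b j : Fin N) → lookup (edge a b) j ≡ does (j ≟ a) ∨ does (j ≟ b)
  lookup-edge a b = lookup∘tabulate _

  edge-comm : (a b : Fin N) → edge a b ≡ edge b a
  edge-comm a b = tabulate-cong (λ j → ∨-comm (does (j ≟ a)) (does (j ≟ b)))

  edge≡edge⇒≡⊎≡ : {a b c d : Fin N} → edge a b ≡ edge c d → a ≡ c ⊎ a ≡ d
  edge≡edge⇒≡⊎≡ {a} {b} {c} {d} ab≡cd with a ≟ c | a ≟ d
  ... | yes a≡c | _       = inj₁ a≡c
  ... | no  _   | yes a≡d = inj₂ a≡d
  ... | no  a≢c | no  a≢d
    with a∈ab≡a∈cd ← trans (sym (lookup-edge a b a))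
                           (trans (cong (λ X → lookup X a) ab≡cd) (lookup-edge c d a))
    rewrite dec-true (a ≟ a) refl | dec-false (a ≟ c) a≢c | dec-false (a ≟ d) a≢d
    with () ← a∈ab≡a∈cd

  edge≡edge⇒≡⊎≡ʳ : {a b c d : Fin N} → edge a b ≡ edge c d → b ≡ c ⊎ b ≡ d
  edge≡edge⇒≡⊎≡ʳ {a} {b} ab≡cd = edge≡edge⇒≡⊎≡ (trans (edge-comm b a) ab≡cd)

  edge-injective : {a b c d : Fin N} → a ≢ d → b ≢ c → edge a b ≡ edge c d → a ≡ c × b ≡ d
  edge-injective a≢d b≢c ab≡cd with edge≡edge⇒≡⊎≡ ab≡cd | edge≡edge⇒≡⊎≡ʳ ab≡cd
  ... | inj₂ a≡d | _        = ⊥-elim (a≢d a≡d)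
  ... | inj₁ _   | inj₁ b≡c = ⊥-elim (b≢c b≡c)
  ... | inj₁ a≡c | inj₂ b≡d = a≡c , b≡d

  image-edge : (π : Permutation′ N) (a b : Fin N) → image π (edge a b) ≡ edge (π ⟨$⟩ʳ a) (π ⟨$⟩ʳ b)
  image-edge π a b = tabulate-cong λ j →
    trans (lookup-edge a b (π ⟨$⟩ˡ j)) (cong₂ _∨_ (moved a) (moved b))
    where
    moved : (c : Fin N) {j : Fin N} → does ((π ⟨$⟩ˡ j) ≟ c) ≡ does (j ≟ (π ⟨$⟩ʳ c))
    moved c {j} = does-⇔ (mk⇔ (λ e → trans (sym (inverseʳ π)) (cong (π ⟨$⟩ʳ_) e))
                              (λ e → trans (cong (π ⟨$⟩ˡ_) e) (inverseˡ π)))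
                         ((π ⟨$⟩ˡ j) ≟ c) (j ≟ (π ⟨$⟩ʳ c))

∣tabulate-false∣ : (N : ℕ) → ∣ tabulate {n = N} (λ _ → false) ∣ˢ ≡ 0
∣tabulate-false∣ zero    = refl
∣tabulate-false∣ (suc N) = ∣tabulate-false∣ N

∣singleton∣ : {N : ℕ} (a : Fin N) → ∣ tabulate (λ j → does (j ≟ a)) ∣ˢ ≡ 1
∣singleton∣ {suc N} zero    = cong suc (∣tabulate-false∣ N)
∣singleton∣         (suc a) = ∣singleton∣ a

∣edge∣≡2 : {N : ℕ} {a b : Fin N} → a ≢ b → ∣ edge a b ∣ˢ ≡ 2
∣edge∣≡2 {a = zero}  {zero}  a≢b = ⊥-elim (a≢b refl)
∣edge∣≡2 {a = zero}  {suc b} _   = cong suc (∣singleton∣ b)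
∣edge∣≡2 {a = suc a} {zero}  a≢b = trans (cong ∣_∣ˢ (edge-comm (suc a) zero)) (∣edge∣≡2 (a≢b ∘ sym))
∣edge∣≡2 {a = suc a} {suc b} a≢b = ∣edge∣≡2 (a≢b ∘ cong suc)

allᵇ-true : {A : Set} (p : A → Bool) (xs : List A) → (∀ x → p x ≡ true) → allᵇ p xs ≡ true
allᵇ-true p []       _      = refl
allᵇ-true p (x ∷ xs) p≡true rewrite p≡true x = allᵇ-true p xs p≡true

edge∈candidates : {N : ℕ} {a b : Fin N} → a ≢ b → edge a b ∈ candidates 2 []
edge∈candidates {N} {a} {b} a≢b =
  ∈-filter⁺ (λ X → ∣ X ∣ˢ ℕ.≟ 2)
    (∈-filter⁺ (λ X → T? (candidate [] X)) (subsets-complete (edge a b)) edge-is-candidate)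
    (∣edge∣≡2 a≢b)
  where
  no-proper-face : ∀ Y → (not (does (Y ⊂? edge a b) ∧ (2 ≤ᵇ ∣ Y ∣ˢ)) ∨ (Y ∈ᵇ [])) ≡ true
  no-proper-face Y with Y ⊂? edge a b
  ... | no  _    = refl
  ... | yes Y⊂ab rewrite dec-false (2 ℕ.≤? ∣ Y ∣ˢ)
                           (ℕ.<⇒≱ (subst (∣ Y ∣ˢ ℕ.<_) (∣edge∣≡2 a≢b) (p⊂q⇒∣p∣<∣q∣ Y⊂ab))) = refl
  edge-is-candidate : T (candidate [] (edge a b))
  edge-is-candidate rewrite allᵇ-true _ (subsets N) no-proper-face = _

-- Rigid graphs

module _ {N : ℕ} where

  EdgePreserving : Faces N → Permutation′ N → Set
  EdgePreserving C π = ∀ {a b} → a ≢ b → edge a b ∈ C ⇔ edge (π ⟨$⟩ʳ a) (π ⟨$⟩ʳ b) ∈ C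

  RigidGraph : Faces N → Set
  RigidGraph C = ∀ π → EdgePreserving C π → ∀ i → π ⟨$⟩ʳ i ≡ i

  SameEdges : Faces N → Faces N → Set
  SameEdges C F = ∀ X → ∣ X ∣ˢ ≡ 2 → X ∈ C ⇔ X ∈ F

  automorphism-preserves-edges : {C F : Faces N} {π : Permutation′ N} →
    SameEdges C F → IsAutomorphism F π → EdgePreserving C π
  automorphism-preserves-edges {C} {F} {π} same aut {a} {b} a≢b = begin
    edge a b ∈ C                   ≈⟨ same (edge a b) (∣edge∣≡2 a≢b) ⟩
    edge a b ∈ F                   ≈⟨ aut (edge a b) ⟩
    image π (edge a b) ∈ F         ≡⟨ cong (_∈ F) (image-edge π a b) ⟩
    edge (π ⟨$⟩ʳ a) (π ⟨$⟩ʳ b) ∈ F ≈⟨ same (edge (π ⟨$⟩ʳ a) (π ⟨$⟩ʳ b)) (∣edge∣≡2 πa≢πb) ⟨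
    edge (π ⟨$⟩ʳ a) (π ⟨$⟩ʳ b) ∈ C ∎
    where
    open import Relation.Binary.Reasoning.Setoid (⇔-setoid 0ℓ)
    πa≢πb = a≢b ∘ ⟨$⟩ʳ-injective π

  rigid⇒trivialAut : {C F : Faces N} → RigidGraph C → SameEdges C F → TrivialAut F
  rigid⇒trivialAut {C} {F} rigid same π aut = rigid π (automorphism-preserves-edges {C} {F} {π} same aut)

module _ {N : ℕ} {P : Faces N → Set} (P? : Decidable P) where

  measureFrom-bounded : (fuel k : ℕ) (F : Faces N) →
                        0ℚ ≤ measureFrom P? fuel k F × measureFrom P? fuel k F ≤ 1ℚ
  measureFrom-bounded zero       k F = 0≤𝟙 (does (P? F)) , 𝟙≤1 (does (P? F))
  measureFrom-bounded (suc fuel) k F =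
    subst (_≤ 𝔼 cs next) (𝔼-const cs 0ℚ) (𝔼-mono cs (λ D _ → proj₁ (bounded D))) ,
    subst (𝔼 cs next ≤_) (𝔼-const cs 1ℚ) (𝔼-mono cs (λ D _ → proj₂ (bounded D)))
    where
    cs = candidates k F
    next = λ D → measureFrom P? fuel (suc k) (F ++ D)
    bounded = λ D → measureFrom-bounded fuel (suc k) (F ++ D)

module _ {N : ℕ} (P? : Decidable (TrivialAut {N})) where

  -- Faces added at stage k ≥ 3 have k vertices, so they are not edges and a
  -- rigid graph stays rigid.
  measureFrom-rigid : {C : Faces N} → RigidGraph C → (fuel k : ℕ) (F : Faces N) →
                      3 ℕ.≤ k → SameEdges C F → measureFrom P? fuel k F ≡ 1ℚ
  measureFrom-rigid rigid zero k F _ same with P? F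
  ... | yes _      = refl
  ... | no  ¬trivF = ⊥-elim (¬trivF (rigid⇒trivialAut rigid same))
  measureFrom-rigid {C} rigid (suc fuel) k F 3≤k same = begin
    𝔼 cs (λ D → measureFrom P? fuel (suc k) (F ++ D))
      ≡⟨ 𝔼-cong cs (λ D D⊆cs → measureFrom-rigid rigid fuel (suc k) (F ++ D) (ℕ.m≤n⇒m≤1+n 3≤k)
                                                                               (same-++ D D⊆cs)) ⟩
    𝔼 cs (const 1ℚ)
      ≡⟨ 𝔼-const cs 1ℚ ⟩
    1ℚ ∎
    where
    open ≡-Reasoning
    cs = candidates k F
    same-++ : ∀ D → D ⊆ cs → SameEdges C (F ++ D)
    same-++ D D⊆cs X ∣X∣≡2 = mk⇔ (∈-++⁺ˡ ∘ Equivalence.to (same X ∣X∣≡2)) from-F++D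
      where
      from-F++D : X ∈ F ++ D → X ∈ C
      from-F++D X∈ with ∈-++⁻ F X∈
      ... | inj₁ X∈F = Equivalence.from (same X ∣X∣≡2) X∈F
      ... | inj₂ X∈D = ⊥-elim (ℕ.<⇒≢ 3≤k (trans (sym ∣X∣≡2) (∈-candidates⁻ k F (D⊆cs X∈D))))

-- Witnesses of a nontrivial edge-preserving permutation

module Witnesses (N : ℕ) where

  open Agreement (_≟ˢ_ {N})
  open import Data.List.Membership.DecPropositional (_≟ˢ_ {N}) using () renaming (_∈?_ to _∈ˢ?_)
  open import Data.List.Relation.Unary.Unique.DecPropositional (_≟ˢ_ {N}) using (unique?)

  Pairs : Set
  Pairs = List (Subset N × Subset N)

  edgeCandidates : List (Subset N)
  edgeCandidates = candidates 2 []

  Valid : ℕ → Pairs → Set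
  Valid K ps = Unique (endpoints ps) × All (_∈ edgeCandidates) (endpoints ps) × K ℕ.≤ length ps

  valid? : (K : ℕ) (ps : Pairs) → Dec (Valid K ps)
  valid? K ps = unique? (endpoints ps) ×-dec All.all? (_∈ˢ? edgeCandidates) (endpoints ps) ×-dec K ℕ.≤? length ps

  -- A witness (K , ps) only counts when ps is valid, so that its probability
  -- is at most 2^−K whatever ps is.
  Witness : Set
  Witness = ℕ × Pairs

  witnessedᵇ : Witness → Faces N → Bool
  witnessedᵇ (K , ps) C = does (valid? K ps) ∧ agreeᵇ ps C

  Witnessed : List Witness → Faces N → Set
  Witnessed ws C = Any (λ w → witnessedᵇ w C ≡ true) ws

  𝔼-witnessed : (w : Witness) → 𝔼 edgeCandidates (𝟙 ∘ witnessedᵇ w) ≤ halfPow (proj₁ w)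
  𝔼-witnessed (K , ps) = 𝔼-checked (valid? K ps)
    where
    𝔼-checked : (valid : Dec (Valid K ps)) →
                𝔼 edgeCandidates (λ C → 𝟙 (does valid ∧ agreeᵇ ps C)) ≤ halfPow K
    𝔼-checked (yes (!E , E⊆ , K≤)) = begin
      𝔼 edgeCandidates (𝟙 ∘ agreeᵇ ps)
        ≡⟨ 𝔼-agree edgeCandidates ps (candidates-unique 2 []) !E (All.lookup E⊆) ⟩
      halfPow (length ps)
        ≤⟨ halfPow-antitone K≤ ⟩
      halfPow K ∎
      where open ℚ.≤-Reasoning
    𝔼-checked (no _) = subst (_≤ halfPow K) (sym (𝔼-const edgeCandidates 0ℚ)) (0≤halfPow K)

  withBound : ℕ → List Pairs → List Witness
  withBound K = map (K ,_)

  witnessed-withBound : {K : ℕ} {ps : Pairs} {pss : List Pairs} {C : Faces N} → ps ∈ pss → Valid K ps →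
                        All (λ (X , Y) → X ∈ C ⇔ Y ∈ C) ps → Witnessed (withBound K pss) C
  witnessed-withBound {K} {ps} {pss} {C} ps∈ valid agree =
    lose (∈-map⁺ (K ,_) ps∈) (subst (λ b → b ∧ agreeᵇ ps C ≡ true) (sym (dec-true (valid? K ps) valid))
                                    (agreeᵇ-intro ps C agree))

  twinPairs : Fin N → Fin N → List (Fin N) → Pairs
  twinPairs i j v = map (λ k → edge i k , edge j k) (others N v)

  twinPairs-valid : {i j : Fin N} (v : List (Fin N)) → i ≢ j → i ∈ v → j ∈ v →
                    Valid (N ∸ length v) (twinPairs i j v)
  twinPairs-valid {i} {j} v i≢j i∈v j∈v =
    endpoints-map-unique (edge i) (edge j) (others N v) (others-unique N v)
      (λ k∈ k′∈ → proj₂ ∘ edge-injective (outside i∈v k′∈) (outside i∈v k∈ ∘ sym))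
      (λ k∈ k′∈ → proj₂ ∘ edge-injective (outside j∈v k′∈) (outside j∈v k∈ ∘ sym))
      (λ k∈ k′∈ → i≢j ∘ proj₁ ∘ edge-injective (outside i∈v k′∈) (outside j∈v k∈ ∘ sym)) ,
    All.tabulate is-candidate ,
    subst (N ∸ length v ℕ.≤_) (sym (length-map _ (others N v))) (length-others N v)
    where
    outside : ∀ {a k} → a ∈ v → k ∈ others N v → a ≢ k
    outside a∈v k∈ refl = ∈-others⁻ N v k∈ a∈v
    is-candidate : ∀ {X} → X ∈ endpoints (twinPairs i j v) → X ∈ edgeCandidates
    is-candidate X∈ with endpoints-map⁻ (edge i) (edge j) (others N v) X∈
    ... | k , k∈ , inj₁ refl = edge∈candidates (outside i∈v k∈)
    ... | k , k∈ , inj₂ refl = edge∈candidates (outside j∈v k∈)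

  twinPairs-agree : {C : Faces N} {π : Permutation′ N} → EdgePreserving C π →
                    {i : Fin N} (v : List (Fin N)) → i ∈ v → (∀ k → k ∉ v → π ⟨$⟩ʳ k ≡ k) →
                    All (λ (X , Y) → X ∈ C ⇔ Y ∈ C) (twinPairs i (π ⟨$⟩ʳ i) v)
  twinPairs-agree {C} {π} preserves {i} v i∈v fixed = All.map⁺ (All.tabulate agree)
    where
    agree : ∀ {k} → k ∈ others N v → edge i k ∈ C ⇔ edge (π ⟨$⟩ʳ i) k ∈ C
    agree {k} k∈ = subst (λ πk → edge i k ∈ C ⇔ edge (π ⟨$⟩ʳ i) πk ∈ C) (fixed k (∈-others⁻ N v k∈))
                         (preserves (λ i≡k → ∈-others⁻ N v k∈ (subst (_∈ v) i≡k i∈v)))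

  shiftPairs : (Fin N → Fin N) → List (Fin N) → Pairs
  shiftPairs f I = map (λ (i , k) → edge i k , edge (f i) (f k)) (cartesianProduct I (others N (I ++ map f I)))

  length-shiftPairs : (f : Fin N → Fin N) (I : List (Fin N)) →
                      length I ℕ.* (N ∸ (length I ℕ.+ length I)) ℕ.≤ length (shiftPairs f I)
  length-shiftPairs f I = begin
    length I ℕ.* (N ∸ (length I ℕ.+ length I))
      ≡⟨ cong (λ n → length I ℕ.* (N ∸ (length I ℕ.+ n))) (length-map f I) ⟨
    length I ℕ.* (N ∸ (length I ℕ.+ length (map f I)))
      ≡⟨ cong (λ n → length I ℕ.* (N ∸ n)) (length-++ I) ⟨
    length I ℕ.* (N ∸ length (I ++ map f I))
      ≤⟨ ℕ.*-monoʳ-≤ (length I) (length-others N (I ++ map f I)) ⟩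
    length I ℕ.* length O
      ≡⟨ length-cartesianProductWith _,_ I O ⟨
    length (cartesianProduct I O)
      ≡⟨ length-map _ (cartesianProduct I O) ⟨
    length (shiftPairs f I) ∎
    where
    open ℕ.≤-Reasoning
    O = others N (I ++ map f I)

  shiftPairs-valid : {f : Fin N → Fin N} → (∀ {a b} → f a ≡ f b → a ≡ b) →
                     (I : List (Fin N)) → Unique I → (∀ {a b} → a ∈ I → b ∈ I → f a ≢ b) →
                     Valid (length I ℕ.* (N ∸ (length I ℕ.+ length I))) (shiftPairs f I)
  shiftPairs-valid {f} f-injective I !I separated =
    endpoints-map-unique P Q I×O (Unique.cartesianProduct⁺ !I (others-unique N (I ++ map f I)))
      (λ ik∈ ik′∈ → ≡-pair ∘ edge-injective (i≢k ik∈ ik′∈) (i≢k ik′∈ ik∈ ∘ sym))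
      (λ ik∈ ik′∈ → ≡-pair ∘ Data.Product.map f-injective f-injective
                     ∘ edge-injective (i≢k ik∈ ik′∈ ∘ f-injective) (i≢k ik′∈ ik∈ ∘ sym ∘ f-injective))
      P≢Q ,
    All.tabulate is-candidate ,
    length-shiftPairs f I
    where
    O = others N (I ++ map f I)
    I×O = cartesianProduct I O
    P Q : Fin N × Fin N → Subset N
    P (i , k) = edge i k
    Q (i , k) = edge (f i) (f k)
    ≡-pair : ∀ {i k i′ k′ : Fin N} → i ≡ i′ × k ≡ k′ → (i , k) ≡ (i′ , k′)
    ≡-pair (refl , refl) = refl
    ∈I×O : ∀ {i k} → (i , k) ∈ I×O → i ∈ I × k ∈ O
    ∈I×O = ∈-cartesianProduct⁻ I O
    k∉I++fI : ∀ {i k} → (i , k) ∈ I×O → k ∉ I ++ map f I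
    k∉I++fI ik∈ = ∈-others⁻ N (I ++ map f I) (proj₂ (∈I×O ik∈))
    i≢k : ∀ {i k i′ k′} → (i , k) ∈ I×O → (i′ , k′) ∈ I×O → i ≢ k′
    i≢k ik∈ ik′∈ refl = k∉I++fI ik′∈ (∈-++⁺ˡ (proj₁ (∈I×O ik∈)))
    P≢Q : ∀ {ik ik′} → ik ∈ I×O → ik′ ∈ I×O → P ik ≢ Q ik′
    P≢Q {i , k} {i′ , k′} ik∈ ik′∈ e with edge≡edge⇒≡⊎≡ e | edge≡edge⇒≡⊎≡ʳ e
    ... | inj₁ i≡fi′ | _          = separated (proj₁ (∈I×O ik′∈)) (proj₁ (∈I×O ik∈)) (sym i≡fi′)
    ... | inj₂ _     | inj₁ k≡fi′ =
      k∉I++fI ik∈ (∈-++⁺ʳ I (subst (_∈ map f I) (sym k≡fi′) (∈-map⁺ f (proj₁ (∈I×O ik′∈)))))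
    ... | inj₂ i≡fk′ | inj₂ k≡fk′ = i≢k ik∈ ik∈ (trans i≡fk′ (sym k≡fk′))
    is-candidate : ∀ {X} → X ∈ endpoints (shiftPairs f I) → X ∈ edgeCandidates
    is-candidate X∈ with endpoints-map⁻ P Q I×O X∈
    ... | (i , k) , ik∈ , inj₁ refl = edge∈candidates (i≢k ik∈ ik∈)
    ... | (i , k) , ik∈ , inj₂ refl = edge∈candidates (i≢k ik∈ ik∈ ∘ f-injective)

  shiftPairs-agree : {C : Faces N} {π : Permutation′ N} → EdgePreserving C π →
                     {f : Fin N → Fin N} → (∀ x → f x ≡ π ⟨$⟩ʳ x) → (I : List (Fin N)) →
                     All (λ (X , Y) → X ∈ C ⇔ Y ∈ C) (shiftPairs f I)
  shiftPairs-agree {C} {π} preserves {f} f≗π I = All.map⁺ (All.tabulate agree)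
    where
    O = others N (I ++ map f I)
    agree : ∀ {ik} → ik ∈ cartesianProduct I O →
            edge (proj₁ ik) (proj₂ ik) ∈ C ⇔ edge (f (proj₁ ik)) (f (proj₂ ik)) ∈ C
    agree {i , k} ik∈ with ∈-cartesianProduct⁻ I O ik∈
    ... | i∈I , k∈O rewrite f≗π i | f≗π k =
      preserves (λ i≡k → ∈-others⁻ N (I ++ map f I) k∈O (∈-++⁺ˡ (subst (_∈ I) i≡k i∈I)))

  twinFamily : ℕ → List Pairs
  twinFamily r = cartesianProductWith (λ (i , j) → twinPairs i j)
                   (cartesianProduct (allFin N) (allFin N)) (lists N (3 ℕ.* r))

  shiftFamily : ℕ → List Pairs
  shiftFamily r = cartesianProductWith (shiftPairs ∘ lookup) (vectors N N) (lists N r)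

  witnesses : ℕ → List Witness
  witnesses r = withBound (N ∸ 3 ℕ.* r) (twinFamily r) ++ withBound (r ℕ.* (N ∸ (r ℕ.+ r))) (shiftFamily r)

  module _ {C : Faces N} {π : Permutation′ N} (preserves : EdgePreserving C π) (r : ℕ) where

    -- twinFamily r only lists v of length exactly 3r, hence the padding.
    twin-witnessed : length (support π) ℕ.≤ 3 ℕ.* r → (i : Fin N) → π ⟨$⟩ʳ i ≢ i →
                     Witnessed (withBound (N ∸ 3 ℕ.* r) (twinFamily r)) C
    twin-witnessed small i πi≢i =
      witnessed-withBound ps∈
        (subst (λ n → Valid (N ∸ n) ps) |v|≡3r (twinPairs-valid v (πi≢i ∘ sym) i∈v πi∈v))
        (twinPairs-agree {C} {π} preserves v i∈v fixed)
      where
      v = support π ++ replicate (3 ℕ.* r ∸ length (support π)) i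
      ps = twinPairs i (π ⟨$⟩ʳ i) v
      |v|≡3r : length v ≡ 3 ℕ.* r
      |v|≡3r = trans (length-++ (support π))
                     (trans (cong (length (support π) ℕ.+_) (length-replicate _)) (ℕ.m+[n∸m]≡n small))
      i∈v = ∈-++⁺ˡ (∈-support⁺ π πi≢i)
      πi∈v = ∈-++⁺ˡ (∈-support⁺ π (πi≢i ∘ ⟨$⟩ʳ-injective π))
      fixed : ∀ k → k ∉ v → π ⟨$⟩ʳ k ≡ k
      fixed k k∉v with π ⟨$⟩ʳ k ≟ k
      ... | yes πk≡k = πk≡k
      ... | no  πk≢k = ⊥-elim (k∉v (∈-++⁺ˡ (∈-support⁺ π πk≢k)))
      ps∈ : ps ∈ twinFamily r
      ps∈ = ∈-cartesianProductWith⁺ (λ (i , j) → twinPairs i j)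
              (∈-cartesianProduct⁺ (∈-allFin i) (∈-allFin (π ⟨$⟩ʳ i)))
              (subst (λ n → v ∈ lists N n) |v|≡3r (∈-lists N v))

    shift-witnessed : 3 ℕ.* r ℕ.≤ length (support π) →
                      Witnessed (withBound (r ℕ.* (N ∸ (r ℕ.+ r))) (shiftFamily r)) C
    shift-witnessed large with separated-points π r (support π) (support-unique π) (support-moved π) large
    ... | I , |I|≡r , !I , _ , separated =
      witnessed-withBound ps∈
        (subst (λ n → Valid (n ℕ.* (N ∸ (n ℕ.+ n))) ps) |I|≡r
               (shiftPairs-valid f-injective I !I (λ a∈ b∈ → separated a∈ b∈ ∘ trans (sym (f≗π _)))))
        (shiftPairs-agree {C} {π} preserves f≗π I)
      where
      f = tabulate (π ⟨$⟩ʳ_)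
      ps = shiftPairs (lookup f) I
      f≗π : ∀ x → lookup f x ≡ π ⟨$⟩ʳ x
      f≗π = lookup∘tabulate (π ⟨$⟩ʳ_)
      f-injective : ∀ {a b} → lookup f a ≡ lookup f b → a ≡ b
      f-injective {a} {b} e = ⟨$⟩ʳ-injective π (trans (sym (f≗π a)) (trans e (f≗π b)))
      ps∈ : ps ∈ shiftFamily r
      ps∈ = ∈-cartesianProductWith⁺ (shiftPairs ∘ lookup) (∈-vectors N f)
              (subst (λ n → I ∈ lists N n) |I|≡r (∈-lists N I))

    moved⇒witnessed : (i : Fin N) → π ⟨$⟩ʳ i ≢ i → Witnessed (witnesses r) C
    moved⇒witnessed i πi≢i with length (support π) ℕ.≤? 3 ℕ.* r
    ... | yes small = Any.++⁺ˡ (twin-witnessed small i πi≢i)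
    ... | no  large = Any.++⁺ʳ (withBound (N ∸ 3 ℕ.* r) (twinFamily r)) (shift-witnessed (ℕ.≰⇒≥ large))

  rigid-unless-witnessed : {C : Faces N} (r : ℕ) → ¬ Witnessed (witnesses r) C → RigidGraph C
  rigid-unless-witnessed {C} r unwitnessed π preserves i with π ⟨$⟩ʳ i ≟ i
  ... | yes πi≡i = πi≡i
  ... | no  πi≢i = ⊥-elim (unwitnessed (moved⇒witnessed {C} {π} preserves r i πi≢i))

  count : List Witness → Faces N → ℚ
  count ws C = sumℚ (map (λ w → 𝟙 (witnessedᵇ w C)) ws)

  0≤count : (ws : List Witness) (C : Faces N) → 0ℚ ≤ count ws C
  0≤count []       C = ℚ.≤-refl
  0≤count (w ∷ ws) C = ℚ.≤-trans (0≤count ws C) (q≤p+q (count ws C) (0≤𝟙 (witnessedᵇ w C)))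

  1≤count : (ws : List Witness) (C : Faces N) → Witnessed ws C → 1ℚ ≤ count ws C
  1≤count (w ∷ ws) C (here w-holds) rewrite w-holds = p≤p+q 1ℚ (0≤count ws C)
  1≤count (w ∷ ws) C (there witnessed) =
    ℚ.≤-trans (1≤count ws C witnessed) (q≤p+q (count ws C) (0≤𝟙 (witnessedᵇ w C)))

  𝔼-count : (ws : List Witness) → 𝔼 edgeCandidates (count ws) ≤ sumℚ (map (halfPow ∘ proj₁) ws)
  𝔼-count ws = subst (_≤ sumℚ (map (halfPow ∘ proj₁) ws))
                     (sym (𝔼-sum edgeCandidates ws (λ w C → 𝟙 (witnessedᵇ w C))))
                     (sumℚ-mono ws 𝔼-witnessed)

  module _ (P? : Decidable (TrivialAut {N})) (r : ℕ) where

    1≤measureFrom+count : (fuel : ℕ) (C : Faces N) → 1ℚ ≤ measureFrom P? fuel 3 C + count (witnesses r) C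
    1≤measureFrom+count fuel C with any? (λ w → witnessedᵇ w C ≟ᵇ true) (witnesses r)
    ... | yes witnessed = ℚ.≤-trans (1≤count (witnesses r) C witnessed)
                            (q≤p+q (count (witnesses r) C) (proj₁ (measureFrom-bounded P? fuel 3 C)))
    ... | no  unwitnessed =
      subst (λ m → 1ℚ ≤ m + count (witnesses r) C)
            (sym (measureFrom-rigid P? (rigid-unless-witnessed r unwitnessed) fuel 3 C ℕ.≤-refl
                                    (λ _ _ → mk⇔ id id)))
            (p≤p+q 1ℚ (0≤count (witnesses r) C))

    measureFrom-lower-bound : (fuel : ℕ) →
      1ℚ ≤ measureFrom P? (suc fuel) 2 [] + sumℚ (map (halfPow ∘ proj₁) (witnesses r))
    measureFrom-lower-bound fuel = begin
      1ℚ
        ≡⟨ 𝔼-const edgeCandidates 1ℚ ⟨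
      𝔼 edgeCandidates (const 1ℚ)
        ≤⟨ 𝔼-mono edgeCandidates (λ C _ → 1≤measureFrom+count fuel C) ⟩
      𝔼 edgeCandidates (λ C → measureFrom P? fuel 3 C + count (witnesses r) C)
        ≡⟨ 𝔼-+ edgeCandidates (measureFrom P? fuel 3) (count (witnesses r)) ⟩
      measureFrom P? (suc fuel) 2 [] + 𝔼 edgeCandidates (count (witnesses r))
        ≤⟨ ℚ.+-monoʳ-≤ (measureFrom P? (suc fuel) 2 []) (𝔼-count (witnesses r)) ⟩
      measureFrom P? (suc fuel) 2 [] + sumℚ (map (halfPow ∘ proj₁) (witnesses r)) ∎
      where open ℚ.≤-Reasoning

  sumℚ-halfPow-withBound : (K : ℕ) (pss : List Pairs) →
                           sumℚ (map (halfPow ∘ proj₁) (withBound K pss)) ≡ length pss ×ℚ halfPow K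
  sumℚ-halfPow-withBound K []         = refl
  sumℚ-halfPow-withBound K (ps ∷ pss) = cong (halfPow K +_) (sumℚ-halfPow-withBound K pss)

  sumℚ-halfPow-witnesses : (r : ℕ) → sumℚ (map (halfPow ∘ proj₁) (witnesses r)) ≡
    length (twinFamily r) ×ℚ halfPow (N ∸ 3 ℕ.* r) + length (shiftFamily r) ×ℚ halfPow (r ℕ.* (N ∸ (r ℕ.+ r)))
  sumℚ-halfPow-witnesses r =
    trans (sumℚ-map-++ (halfPow ∘ proj₁) (withBound _ (twinFamily r)) (withBound _ (shiftFamily r)))
          (cong₂ _+_ (sumℚ-halfPow-withBound _ (twinFamily r)) (sumℚ-halfPow-withBound _ (shiftFamily r)))

  length-twinFamily : (r : ℕ) → length (twinFamily r) ≡ N ^ (2 ℕ.+ 3 ℕ.* r)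
  length-twinFamily r = begin
    length (twinFamily r)
      ≡⟨ length-cartesianProductWith _ (cartesianProduct (allFin N) (allFin N)) (lists N (3 ℕ.* r)) ⟩
    length (cartesianProduct (allFin N) (allFin N)) ℕ.* length (lists N (3 ℕ.* r))
      ≡⟨ cong₂ ℕ._*_ (length-cartesianProductWith _,_ (allFin N) (allFin N)) (length-lists N (3 ℕ.* r)) ⟩
    length (allFin N) ℕ.* length (allFin N) ℕ.* N ^ (3 ℕ.* r)
      ≡⟨ cong₂ (λ m n → m ℕ.* n ℕ.* N ^ (3 ℕ.* r)) (length-allFin N) (length-allFin N) ⟩
    N ℕ.* N ℕ.* N ^ (3 ℕ.* r)
      ≡⟨ ℕ.*-assoc N N (N ^ (3 ℕ.* r)) ⟩
    N ^ (2 ℕ.+ 3 ℕ.* r) ∎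
    where open ≡-Reasoning

  length-shiftFamily : (r : ℕ) → length (shiftFamily r) ≡ N ^ (N ℕ.+ r)
  length-shiftFamily r = begin
    length (shiftFamily r)                      ≡⟨ length-cartesianProductWith _ (vectors N N) (lists N r) ⟩
    length (vectors N N) ℕ.* length (lists N r) ≡⟨ cong₂ ℕ._*_ (length-vectors N N) (length-lists N r) ⟩
    N ^ N ℕ.* N ^ r                             ≡⟨ ℕ.^-distribˡ-+-* N N r ⟨
    N ^ (N ℕ.+ r)                               ∎
    where open ≡-Reasoning

-- Choice of parameters

-- 2ⁿ - 1, the denominator of halfPow n as an unnormalised rational.
mersenne : ℕ → ℕ
mersenne zero    = 0
mersenne (suc n) = suc (mersenne n ℕ.+ mersenne n)

suc-mersenne : (n : ℕ) → suc (mersenne n) ≡ 2 ^ n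
suc-mersenne zero    = refl
suc-mersenne (suc n) = begin
  suc (suc (mersenne n ℕ.+ mersenne n))  ≡⟨ cong suc (ℕ.+-suc (mersenne n) (mersenne n)) ⟨
  suc (mersenne n) ℕ.+ suc (mersenne n)  ≡⟨ cong₂ ℕ._+_ (suc-mersenne n) (suc-mersenne n) ⟩
  2 ^ n ℕ.+ 2 ^ n                        ≡⟨ cong (2 ^ n ℕ.+_) (ℕ.+-identityʳ (2 ^ n)) ⟨
  2 ^ n ℕ.+ (2 ^ n ℕ.+ 0)                ∎
  where open ≡-Reasoning

toℚᵘ-halfPow : (n : ℕ) → toℚᵘ (halfPow n) ℚᵘ.≃ mkℚᵘ (ℤ.+ 1) (mersenne n)
toℚᵘ-halfPow zero    = ℚᵘ.≃-refl
toℚᵘ-halfPow (suc n) =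
  ℚᵘ.≃-trans (ℚ.toℚᵘ-homo-* ½ (halfPow n))
    (ℚᵘ.≃-trans (ℚᵘ.*-congˡ {mkℚᵘ (ℤ.+ 1) 1} (toℚᵘ-halfPow n)) (ℚᵘ.*≡* cross))
  where
  m = mersenne n
  cross : (ℤ.+ 1 ℤ.* ℤ.+ 1) ℤ.* ℤ.+ suc (suc (m ℕ.+ m)) ≡ ℤ.+ 1 ℤ.* ℤ.+ (2 ℕ.* suc m)
  cross = trans (ℤ.*-identityˡ _)
         (trans (cong (ℤ.+_ ∘ suc) (sym (ℕ.+-suc m m)))
                (sym (trans (ℤ.*-identityˡ _) (cong (λ k → ℤ.+ (suc m ℕ.+ k)) (ℕ.+-identityʳ (suc m))))))

halfPow<ε : (ε : ℚ) → 0ℚ < ε → (n : ℕ) → suc (ℚ.denominator-1 ε) ℕ.< 2 ^ n → halfPow n < ε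
halfPow<ε (mkℚ (ℤ.+ zero)    _ _) (*<* (ℤ.+<+ ()))
halfPow<ε (mkℚ ℤ.-[1+ _ ]    _ _) (*<* ())
halfPow<ε (mkℚ (ℤ.+ suc p) d _) _ n d<2^n =
  ℚ.toℚᵘ-cancel-< (ℚᵘ.<-respˡ-≃ (ℚᵘ.≃-sym (toℚᵘ-halfPow n)) (ℚᵘ.*<* cross))
  where
  cross : ℤ.+ 1 ℤ.* ℤ.+ suc d ℤ.< ℤ.+ suc p ℤ.* ℤ.+ suc (mersenne n)
  cross = subst₂ ℤ._<_ (sym (ℤ.*-identityˡ (ℤ.+ suc d))) (ℤ.pos-* (suc p) (suc (mersenne n)))
            (ℤ.+<+ (ℕ.<-≤-trans d<2^n (subst (λ m → 2 ^ n ℕ.≤ suc p ℕ.* m) (sym (suc-mersenne n))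
                                                 (ℕ.m≤n*m (2 ^ n) (suc p)))))

dyadic-bracket : (n : ℕ) → ∃[ L ] (suc n ℕ.≤ 2 ^ L × 2 ^ L ℕ.≤ 2 ℕ.* suc n)
dyadic-bracket zero    = 0 , ℕ.≤-refl , ℕ.s≤s ℕ.z≤n
dyadic-bracket (suc n) with dyadic-bracket n
... | L , N≤2^L , 2^L≤2N with suc (suc n) ℕ.≤? 2 ^ L
...   | yes N+1≤2^L = L , N+1≤2^L , ℕ.≤-trans 2^L≤2N (ℕ.*-monoʳ-≤ 2 (ℕ.n≤1+n (suc n)))
...   | no  N+1≰2^L = suc L , subst (suc (suc n) ℕ.≤_) (cong (2 ℕ.*_) (sym 2^L≡N)) N+1≤2N
                            , subst (ℕ._≤ 2 ℕ.* suc (suc n)) (cong (2 ℕ.*_) (sym 2^L≡N))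
                                    (ℕ.*-monoʳ-≤ 2 (ℕ.n≤1+n (suc n)))
  where
  2^L≡N : 2 ^ L ≡ suc n
  2^L≡N = ℕ.≤-antisym (ℕ.≤-pred (ℕ.≰⇒> N+1≰2^L)) N≤2^L
  N+1≤2N : suc (suc n) ℕ.≤ 2 ℕ.* suc n
  N+1≤2N = subst (suc (suc n) ℕ.≤_) (cong (suc n ℕ.+_) (sym (ℕ.+-identityʳ (suc n))))
                 (ℕ.+-monoˡ-≤ (suc n) (ℕ.s≤s (ℕ.z≤n {n})))

-- With N ≤ 2^L vertices there are at most 2^(L e) witnesses of each kind, with
-- e = 2 + 3r for twins and e = N + r for shifts, and each has probability at
-- most 2^−K; the choice r = points L makes K ≥ L e + L + 1 for both kinds as
-- soon as N ≥ threshold L.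
points : ℕ → ℕ
points L = suc (2 ℕ.* L)

threshold : ℕ → ℕ
threshold L = L ℕ.* (2 ℕ.+ 3 ℕ.* points L) ℕ.+ suc L ℕ.+ 3 ℕ.* points L

module _ {L N : ℕ} (large : threshold L ℕ.≤ N) where

  private
    r = points L

  twin-exponent : L ℕ.* (2 ℕ.+ 3 ℕ.* r) ℕ.+ suc L ℕ.≤ N ∸ 3 ℕ.* r
  twin-exponent = ℕ.m+n≤o⇒m≤o∸n _ large

  shift-exponent : L ℕ.* (N ℕ.+ r) ℕ.+ suc L ℕ.≤ r ℕ.* (N ∸ (r ℕ.+ r))
  shift-exponent = begin
    L ℕ.* (N ℕ.+ r) ℕ.+ suc L              ≡⟨ cong (λ n → L ℕ.* (n ℕ.+ r) ℕ.+ suc L) N≡r+r+M ⟨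
    L ℕ.* ((r ℕ.+ r ℕ.+ M) ℕ.+ r) ℕ.+ suc L ≡⟨ regroup L M r ⟩
    L ℕ.* M ℕ.+ (L ℕ.* (3 ℕ.* r) ℕ.+ suc L) ≤⟨ ℕ.+-monoʳ-≤ (L ℕ.* M) 3Lr+L≤M ⟩
    L ℕ.* M ℕ.+ M                          ≤⟨ ℕ.+-monoʳ-≤ (L ℕ.* M) (ℕ.m≤n+m M (L ℕ.* M)) ⟩
    L ℕ.* M ℕ.+ (L ℕ.* M ℕ.+ M)            ≡⟨ expand L M ⟨
    r ℕ.* M                                ∎
    where
    open ℕ.≤-Reasoning
    open import Data.Nat.Tactic.RingSolver using (solve-∀)
    M = N ∸ (r ℕ.+ r)
    -- The ring solver does not unfold threshold and points, so they are unfolded by hand.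
    threshold-split : threshold L ≡ (r ℕ.+ r) ℕ.+ (L ℕ.* (3 ℕ.* r) ℕ.+ suc L) ℕ.+ (L ℕ.+ L ℕ.+ r)
    threshold-split = split L
      where
      split : ∀ L → L ℕ.* (2 ℕ.+ 3 ℕ.* suc (2 ℕ.* L)) ℕ.+ suc L ℕ.+ 3 ℕ.* suc (2 ℕ.* L)
                  ≡ (suc (2 ℕ.* L) ℕ.+ suc (2 ℕ.* L)) ℕ.+ (L ℕ.* (3 ℕ.* suc (2 ℕ.* L)) ℕ.+ suc L)
                    ℕ.+ (L ℕ.+ L ℕ.+ suc (2 ℕ.* L))
      split = solve-∀
    r+r+3Lr+L≤N : (r ℕ.+ r) ℕ.+ (L ℕ.* (3 ℕ.* r) ℕ.+ suc L) ℕ.≤ N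
    r+r+3Lr+L≤N = ℕ.m+n≤o⇒m≤o _ (subst (ℕ._≤ N) threshold-split large)
    N≡r+r+M : r ℕ.+ r ℕ.+ M ≡ N
    N≡r+r+M = ℕ.m+[n∸m]≡n (ℕ.m+n≤o⇒m≤o (r ℕ.+ r) r+r+3Lr+L≤N)
    3Lr+L≤M : L ℕ.* (3 ℕ.* r) ℕ.+ suc L ℕ.≤ M
    3Lr+L≤M = ℕ.m+n≤o⇒m≤o∸n _ (subst (ℕ._≤ N) (ℕ.+-comm (r ℕ.+ r) _) r+r+3Lr+L≤N)
    regroup : ∀ L M r → L ℕ.* ((r ℕ.+ r ℕ.+ M) ℕ.+ r) ℕ.+ suc L
                      ≡ L ℕ.* M ℕ.+ (L ℕ.* (3 ℕ.* r) ℕ.+ suc L)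
    regroup = solve-∀
    expand : ∀ L M → suc (2 ℕ.* L) ℕ.* M ≡ L ℕ.* M ℕ.+ (L ℕ.* M ℕ.+ M)
    expand = solve-∀

threshold-suc : (L : ℕ) → 2 ℕ.≤ L → threshold (suc L) ℕ.≤ 2 ℕ.* threshold L
threshold-suc L 2≤L = subst₂ ℕ._≤_ (sym (at-suc L)) (sym (doubled L))
  (ℕ.+-monoʳ-≤ (6 ℕ.* L ℕ.* L ℕ.+ 24 ℕ.* L ℕ.+ 8)
    (ℕ.≤-trans (ℕ.≤ᵇ⇒≤ 14 24 _) (ℕ.*-mono-≤ (ℕ.*-monoʳ-≤ 6 2≤L) 2≤L)))
  where
  open import Data.Nat.Tactic.RingSolver using (solve-∀)
  at-suc : ∀ L → suc L ℕ.* (2 ℕ.+ 3 ℕ.* suc (2 ℕ.* suc L)) ℕ.+ suc (suc L) ℕ.+ 3 ℕ.* suc (2 ℕ.* suc L)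
                 ≡ (6 ℕ.* L ℕ.* L ℕ.+ 24 ℕ.* L ℕ.+ 8) ℕ.+ 14
  at-suc = solve-∀
  doubled : ∀ L → 2 ℕ.* (L ℕ.* (2 ℕ.+ 3 ℕ.* suc (2 ℕ.* L)) ℕ.+ suc L ℕ.+ 3 ℕ.* suc (2 ℕ.* L))
                  ≡ (6 ℕ.* L ℕ.* L ℕ.+ 24 ℕ.* L ℕ.+ 8) ℕ.+ 6 ℕ.* L ℕ.* L
  doubled = solve-∀

2*threshold≤2^ : (t : ℕ) → 2 ℕ.* threshold (11 ℕ.+ t) ℕ.≤ 2 ^ (11 ℕ.+ t)
2*threshold≤2^ zero    = ℕ.≤ᵇ⇒≤ _ _ _
2*threshold≤2^ (suc t) =
  ℕ.*-monoʳ-≤ 2 (ℕ.≤-trans (threshold-suc (11 ℕ.+ t) (ℕ.m≤m+n 2 (9 ℕ.+ t))) (2*threshold≤2^ t))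

∣p-1∣≤h : {p h : ℚ} → p ≤ 1ℚ → 1ℚ ≤ p + h → ∣ p - 1ℚ ∣ ≤ h
∣p-1∣≤h {p} {h} p≤1 1≤p+h = begin
  ∣ p - 1ℚ ∣       ≡⟨ ℚ.∣-p∣≡∣p∣ (p - 1ℚ) ⟨
  ∣ - (p - 1ℚ) ∣   ≡⟨ cong ∣_∣ (negate p) ⟩
  ∣ 1ℚ - p ∣       ≡⟨ ℚ.0≤p⇒∣p∣≡p 0≤1-p ⟩
  1ℚ - p           ≤⟨ ℚ.+-monoˡ-≤ (- p) 1≤p+h ⟩
  (p + h) - p      ≡⟨ cancel p h ⟩
  h                ∎
  where
  open ℚ.≤-Reasoning
  open import Data.Rational.Solver using (module +-*-Solver)
  open +-*-Solver
  negate : ∀ p → - (p - 1ℚ) ≡ 1ℚ - p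
  negate = solve 1 (λ p → :- (p :- con 1ℚ) := con 1ℚ :- p) refl
  cancel : ∀ p h → (p + h) - p ≡ h
  cancel = solve 2 (λ p h → (p :+ h) :- p := h) refl
  0≤1-p : 0ℚ ≤ 1ℚ - p
  0≤1-p = subst (_≤ 1ℚ - p) (ℚ.+-inverseʳ p) (ℚ.+-monoˡ-≤ (- p) p≤1)

module _ (n : ℕ) (P? : Decidable (TrivialAut {suc (suc n)})) where

  private
    N : ℕ
    N = suc (suc n)

  open Witnesses N

  ∣μ-1∣≤halfPow : {L : ℕ} → N ℕ.≤ 2 ^ L → threshold L ℕ.≤ N → ∣ μ N P? - 1ℚ ∣ ≤ halfPow L
  ∣μ-1∣≤halfPow {L} N≤2^L large = ∣p-1∣≤h (proj₂ (measureFrom-bounded P? (suc n) 2 [])) (begin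
    1ℚ
      ≤⟨ measureFrom-lower-bound P? r n ⟩
    μ N P? + sumℚ (map (halfPow ∘ proj₁) (witnesses r))
      ≡⟨ cong (μ N P? +_) (sumℚ-halfPow-witnesses r) ⟩
    μ N P? + (length (twinFamily r) ×ℚ halfPow (N ∸ 3 ℕ.* r)
              + length (shiftFamily r) ×ℚ halfPow (r ℕ.* (N ∸ (r ℕ.+ r))))
      ≤⟨ ℚ.+-monoʳ-≤ (μ N P?) (ℚ.+-mono-≤ twin-bound shift-bound) ⟩
    μ N P? + (halfPow (suc L) + halfPow (suc L))
      ≡⟨ cong (μ N P? +_) (halfPow-suc+halfPow-suc L) ⟩
    μ N P? + halfPow L ∎)
    where
    open ℚ.≤-Reasoning
    r = points L
    N^e≤2^Le : ∀ e → N ^ e ℕ.≤ 2 ^ (L ℕ.* e)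
    N^e≤2^Le e = subst (N ^ e ℕ.≤_) (ℕ.^-*-assoc 2 L e) (ℕ.^-monoˡ-≤ e N≤2^L)
    twin-bound : length (twinFamily r) ×ℚ halfPow (N ∸ 3 ℕ.* r) ≤ halfPow (suc L)
    twin-bound = ×ℚ-halfPow-≤ {d = L ℕ.* (2 ℕ.+ 3 ℕ.* r)}
      (subst (ℕ._≤ 2 ^ (L ℕ.* (2 ℕ.+ 3 ℕ.* r))) (sym (length-twinFamily r)) (N^e≤2^Le (2 ℕ.+ 3 ℕ.* r)))
      (twin-exponent large)
    shift-bound : length (shiftFamily r) ×ℚ halfPow (r ℕ.* (N ∸ (r ℕ.+ r))) ≤ halfPow (suc L)
    shift-bound = ×ℚ-halfPow-≤ {d = L ℕ.* (N ℕ.+ r)}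
      (subst (ℕ._≤ 2 ^ (L ℕ.* (N ℕ.+ r))) (sym (length-shiftFamily r)) (N^e≤2^Le (N ℕ.+ r)))
      (shift-exponent large)

proposition5p12 : (dec : (N : ℕ) → Decidable (TrivialAut {N}))
    → (ε : ℚ) → 0ℚ < ε
    → ∃[ N₀ ] ((N : ℕ) → N ≥ N₀ → ∣ μ N (dec N) - 1ℚ ∣ < ε)
proposition5p12 dec ε 0<ε = 2 ^ 12 ℕ.+ suc q , close
  where
  -- N ≥ 2^12 forces L ≥ 11, where 2 threshold L ≤ 2^L ≤ 2N; N > q + 1 forces 2^−L < ε.
  q = ℚ.denominator-1 ε
  close : (N : ℕ) → N ≥ 2 ^ 12 ℕ.+ suc q → ∣ μ N (dec N) - 1ℚ ∣ < ε
  close 1 (ℕ.s≤s ())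
  close (suc (suc n)) N≥N₀ with dyadic-bracket (suc n)
  ... | L , N≤2^L , 2^L≤2N =
    ℚ.≤-<-trans (∣μ-1∣≤halfPow n (dec _) N≤2^L large) (halfPow<ε ε 0<ε L q<2^L)
    where
    2^12≤2^L : 2 ^ 12 ℕ.≤ 2 ^ L
    2^12≤2^L = ℕ.≤-trans (ℕ.m≤m+n (2 ^ 12) (suc q)) (ℕ.≤-trans N≥N₀ N≤2^L)
    q<2^L : suc q ℕ.< 2 ^ L
    q<2^L = ℕ.<-≤-trans (ℕ.m<n+m (suc q) (ℕ.m^n>0 2 12)) (ℕ.≤-trans N≥N₀ N≤2^L)
    11≤L : 11 ℕ.≤ L
    11≤L = ℕ.≮⇒≥ λ L<11 → ℕ.<⇒≱ (ℕ.^-monoʳ-< 2 (ℕ.s≤s (ℕ.s≤s ℕ.z≤n)) (ℕ.m≤n⇒m≤1+n L<11))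
                                 2^12≤2^L
    large : threshold L ℕ.≤ suc (suc n)
    large = ℕ.*-cancelˡ-≤ 2 (ℕ.≤-trans (subst (λ m → 2 ℕ.* threshold m ℕ.≤ 2 ^ m) (ℕ.m+[n∸m]≡n 11≤L)
                                              (2*threshold≤2^ (L ∸ 11)))
                                       2^L≤2N)
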